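{- Let $0<k<n$ and let $\mathcal P\subset\mathbb{R}^n$ be the polytope defined by $x_1+\dots+x_n=k$, $0\le x_i\le1$ for all $i$, and $b_{ij}\le x_{i+1}+\dots+x_j\le c_{ij}$ for all $0\le i<j\le n-1$, where $b_{ij},c_{ij}$ are integers. Let $W_{\mathcal P}$ be the set of permutations $w=w_1\cdots w_{n-1}\in S_{n-1}$ such that, with the convention $w_0=0$: (1) $w$ has exactly $k-1$ descents; (2) for each $0\le i<j\le n-1$ the sequence $w_i w_{i+1}\cdots w_j$ has at least $b_{ij}$ descents, and if it has exactly $b_{ij}$ descents then $w_i<w_j$; (3) for each $0\le i<j\le n-1$ the sequence $w_iw_{i+1}\cdots w_j$ has at most $c_{ij}$ descents, and if it has exactly $c_{ij}$ descents then $w_i>w_j$. Then the normalized volume of $\mathcal P$ equals $|W_{\mathcal P}|$.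
   Context: A descent of a sequence $s_1s_2\cdots s_m$ is an index $t$ with $s_t>s_{t+1}$. The normalized volume is the $(n-1)$-dimensional volume in the hyperplane $x_1+\dots+x_n=k$, normalized so that unimodular simplices have volume 1 (equivalently $(n-1)!$ times the Euclidean volume of the projection to the first $n-1$ coordinates). -}

module Defs where

open import Data.Bool using (Bool; true; false; _∧_; if_then_else_)
open import Data.Nat as ℕ using (ℕ; zero; suc; _+_; _*_; _∸_; _<ᵇ_; _≤ᵇ_)
open import Data.Integer as ℤ using (ℤ; +_)
open import Data.List using (List; []; _∷_; length; filter; concatMap; map; upTo)
open import Data.Vec as Vec using (Vec; []; _∷_; toList)
open import Data.Product using (_×_)
open import Relation.Binary.PropositionalEquality using (_≡_)
open import Data.List.Relation.Binary.Permutation.Propositional using (_↭_)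
open import Relation.Nullary.Decidable using (does)
open import Data.Rational as ℚ using (ℚ)

-- 0-indexed access to a list (default 0 out of range; only used in range)

at : List ℕ → ℕ → ℕ
at []       _       = 0
at (x ∷ xs) zero    = x
at (x ∷ xs) (suc p) = at xs p

-- Permutations w ∈ S_m in one-line notation w = w_1 ... w_m, stored as
-- Vec ℕ m, with the convention w_0 = 0.

IsPerm : ∀ {m} → Vec ℕ m → Set
IsPerm {m} w = toList w ↭ map suc (upTo m)

wseq : ∀ {m} → Vec ℕ m → ℕ → ℕ
wseq w zero    = 0
wseq w (suc p) = at (toList w) p

descFrom : (ℕ → ℕ) → ℕ → ℕ → ℕ
descFrom s i zero      = 0
descFrom s i (suc len) =
  (if s (suc i) <ᵇ s i then 1 else 0) + descFrom s (suc i) len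

des : ∀ {m} → Vec ℕ m → ℕ → ℕ → ℕ
des w i j = descFrom (wseq w) i (j ∸ i)

record InW (n k : ℕ) (b c : ℕ → ℕ → ℤ) (w : Vec ℕ (n ∸ 1)) : Set where
  field
    perm  : IsPerm w
    cond1 : des w 1 (n ∸ 1) ≡ k ∸ 1
    cond2 : ∀ i j → i ℕ.< j → j ℕ.≤ n ∸ 1 →
              (b i j ℤ.≤ + des w i j)
            × (b i j ≡ + des w i j → wseq w i ℕ.< wseq w j)
    cond3 : ∀ i j → i ℕ.< j → j ℕ.≤ n ∸ 1 →
              (+ des w i j ℤ.≤ c i j)
            × (c i j ≡ + des w i j → wseq w j ℕ.< wseq w i)

-- Volume of P as a Jordan content: count the points of the grid
-- (1/t)ℤ^{n-1} lying in the projection of P to the first n-1 coordinates.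
-- Scaling by t, these are the z ∈ ℤ^{n-1} with x = z/t, i.e.
--   0 ≤ z_p ≤ t              (p = 1..n-1)
--   0 ≤ t k - Σ z_p ≤ t      (x_n = k - x_1 - ... - x_{n-1} ∈ [0,1])
--   t b_ij ≤ z_{i+1}+...+z_j ≤ t c_ij   (0 ≤ i < j ≤ n-1)

grid : (t m : ℕ) → List (Vec ℕ m)
grid t zero    = [] ∷ []
grid t (suc m) = concatMap (λ a → map (a ∷_) (grid t m)) (upTo (suc t))

-- z_{i+1} + ... + z_j  (z stored 0-indexed as z_1 ... z_m)
partSum : List ℕ → ℕ → ℕ → ℕ
partSum z i zero      = 0
partSum z i (suc len) = at z i + partSum z (suc i) len

S : ∀ {m} → Vec ℕ m → ℕ → ℕ → ℕ
S z i j = partSum (toList z) i (j ∸ i)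

pairs : ℕ → List (ℕ Data.Product.× ℕ)
pairs m = concatMap (λ j → map (λ i → i Data.Product., j) (upTo j)) (upTo (suc m))

allB : {A : Set} → (A → Bool) → List A → Bool
allB p []       = true
allB p (x ∷ xs) = p x ∧ allB p xs

inScaledP : (n k t : ℕ) (b c : ℕ → ℕ → ℤ) → Vec ℕ (n ∸ 1) → Bool
inScaledP n k t b c z =
      (S z 0 (n ∸ 1) ≤ᵇ t * k)
    ∧ (t * k ≤ᵇ S z 0 (n ∸ 1) + t)
    ∧ allB (λ { (i Data.Product., j) →
              does ((+ t) ℤ.* b i j ℤ.≤? + S z i j)
            ∧ does (+ S z i j ℤ.≤? (+ t) ℤ.* c i j) })
          (pairs (n ∸ 1))

gridCount : (n k t : ℕ) (b c : ℕ → ℕ → ℤ) → ℕ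
gridCount n k t b c = length (filter (λ z → Data.Bool.T? (inScaledP n k t b c z)) (grid t (n ∸ 1)))

ℕtoℚ : ℕ → ℚ
ℕtoℚ a = (+ a) ℚ./ 1

-- Write T = t + 1. A lattice point z of T·P (projected to ℤ^(n−1)) with all zᵢ ≤ t is the sequence of
-- cyclic differences of a residue vector r ∈ {0, …, t}^(n−1), r₀ = 0, namely of its partial sums modulo T,
-- and these telescope: z_{i+1} + ⋯ + z_j = T · des(r; i, j) + r_j − r_i, since each wrap-around modulo T
-- is a descent of r. When 0, r₁, …, r_{n−1} are distinct, the inequalities defining T·P thereby become
-- conditions (1)–(3) for the permutation w = rank r, which has the same descents and relative order.
-- Each w ∈ W_P is the rank of exactly C(t, n−1) such r, namely r = a ∘ w with 0 < a₁ < ⋯ < a_{n−1} ≤ t.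
-- The remaining lattice points number O(T^(n−2)), and (n−1)! · C(t, n−1) = t(t−1)⋯(t−n+2) differs from
-- T^(n−1) by O(T^(n−2)); hence (n−1)! · #(T·P ∩ ℤ^(n−1)) / T^(n−1) → |W_P|.

module Submission where

open import Defs
open import Data.Nat as ℕ using (ℕ; suc; _*_; _∸_; _^_; _!; _<_; _≤_)
open import Data.Integer as ℤ using (ℤ)
open import Data.Rational as ℚ using (ℚ)
open import Data.Vec using (Vec)
open import Data.List using (List; length)
open import Data.List.Membership.Propositional using (_∈_)
open import Data.List.Relation.Unary.Unique.Propositional using (Unique)
open import Data.Product using (Σ; _×_)
open import Function.Bundles using (_⇔_)

open import Data.Bool using (Bool; true; false; T; T?; _∧_; not; if_then_else_)
open import Data.Bool.ListAction using (all)
open import Data.Bool.Properties using (T-∧; ∧-zeroʳ; ∧-identityʳ)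
open import Data.Empty using (⊥; ⊥-elim)
open import Data.Integer.Base using (_⊖_)
import Data.Integer.Properties as ℤP
open import Data.List using ([]; _∷_; _++_; filter; concatMap; map; upTo)
open import Data.List.Properties
  using (++-identityʳ; length-++; length-map; length-upTo; map-++; map-cong-local; map-upTo; map-applyUpTo; upTo-∷ʳ)
open import Data.List.Membership.Propositional using (_∉_; find)
open import Data.List.Membership.Propositional.Properties
  using (∈-∃++; ∈-filter⁺; ∈-filter⁻; ∈-++⁻; ∈-++⁺ˡ; ∈-++⁺ʳ; ∈-map⁺; ∈-map⁻; ∈-upTo⁺; ∈-upTo⁻; ∈-concatMap⁺; ∈-concatMap⁻)
open import Data.List.Relation.Binary.Permutation.Propositional
  using (_↭_; ↭-sym; ↭-trans; ↭-refl; ↭-reflexive; ↭-prep; ↭⇒↭ₛ)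
open import Data.List.Relation.Binary.Permutation.Propositional.Properties using (shift; ↭-length; ∈-resp-↭; filter-↭)
import Data.List.Relation.Binary.Permutation.Setoid.Properties as PermSetoid
open import Data.List.Relation.Binary.Subset.Propositional using (_⊆_)
open import Data.List.Relation.Unary.All as All using (All; []; _∷_)
open import Data.List.Relation.Unary.AllPairs using ([]; _∷_)
open import Data.List.Relation.Unary.Any as Any using (Any; here; there)
import Data.List.Relation.Unary.Unique.Propositional.Properties as UniqueP
open import Data.Nat using (zero; _+_; z≤n; s≤s; _<ᵇ_; _≤ᵇ_; _≡ᵇ_)
open import Data.Nat.Combinatorics
  using (_C_; _P_; nPk≡n!/[n∸k]!; k>n⇒nPk≡0; nCk≡nPk/k!; k>n⇒nCk≡0; nP1≡n; nCk+nC[k+1]≡[n+1]C[k+1])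
open import Data.Nat.Combinatorics.Base using (_P′_)
open import Data.Nat.Combinatorics.Specification using (nP′k≡n!/[n∸k]!; nP′k≡n[n∸1P′k∸1]; k!∣nP′k)
import Data.Nat.Coprimality as Coprime
open import Data.Nat.Divisibility using (_∣_)
open import Data.Nat.DivMod using (_/_; m*[n/m]≡n)
open import Data.Nat.ListAction using (sum)
open import Data.Nat.ListAction.Properties using (sum-++)
open import Data.Nat.Properties
open import Data.Nat.Solver using (module +-*-Solver)
open import Data.List.Membership.DecPropositional _≟_ using (_∈?_)
open import Data.List.Relation.Unary.Unique.DecPropositional _≟_ using (unique?)
open import Data.Product using (∃; _,_; proj₁; proj₂; map₂)
open import Data.Rational.Base using (mkℚ)
import Data.Rational.Properties as ℚP
open import Data.Rational.Unnormalised.Base as ℚᵘ using (mkℚᵘ)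
import Data.Rational.Unnormalised.Properties as ℚᵘP
open import Data.Sum using (inj₁; inj₂)
import Data.Vec as Vec
open import Data.Vec using ([]; _∷_; toList; iterate)
open import Data.Vec.Properties using (length-toList; toList-map; ∷-injectiveˡ; ∷-injectiveʳ; ≡-dec)
open import Function using (_∘_; id)
open import Function.Bundles using (mk⇔; Equivalence)
import Function.Properties.Equivalence as ⇔
open import Relation.Binary using (DecidableEquality; tri<; tri≈; tri>)
open import Relation.Binary.PropositionalEquality
  using (_≡_; _≢_; refl; sym; trans; cong; cong₂; subst; subst₂; setoid; module ≡-Reasoning)
open import Relation.Nullary using (¬_; Dec; yes; no; does)
open import Relation.Nullary.Decidable using (map′; _×-dec_; _→-dec_)

open +-*-Solver using (solve; _:+_; _:*_; _:=_; con)

variable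
  A B : Set
  x y : A
  xs ys : List A
  p q : A → Bool

T⇒≡true : ∀ {b} → T b → b ≡ true
T⇒≡true {true} _ = refl

¬T⇒≡false : ∀ {b} → ¬ T b → b ≡ false
¬T⇒≡false {true}  ¬b = ⊥-elim (¬b _)
¬T⇒≡false {false} _  = refl

indicator : Bool → ℕ
indicator b = if b then 1 else 0

count : (A → Bool) → List A → ℕ
count p []       = 0
count p (x ∷ xs) = indicator (p x) + count p xs

length-filter≡count : (p : A → Bool) (xs : List A) → length (filter (λ x → T? (p x)) xs) ≡ count p xs
length-filter≡count p []       = refl
length-filter≡count p (x ∷ xs) with p x
... | true  = cong suc (length-filter≡count p xs)
... | false = length-filter≡count p xs

count-++ : (p : A → Bool) (xs ys : List A) → count p (xs ++ ys) ≡ count p xs + count p ys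
count-++ p []       ys = refl
count-++ p (x ∷ xs) ys = trans (cong (indicator (p x) +_) (count-++ p xs ys)) (sym (+-assoc (indicator (p x)) _ _))

count-map : (p : B → Bool) (f : A → B) (xs : List A) → count p (map f xs) ≡ count (p ∘ f) xs
count-map p f []       = refl
count-map p f (x ∷ xs) = cong (indicator (p (f x)) +_) (count-map p f xs)

count-concatMap : (p : B → Bool) (f : A → List B) (xs : List A) →
                  count p (concatMap f xs) ≡ sum (map (count p ∘ f) xs)
count-concatMap p f []       = refl
count-concatMap p f (x ∷ xs) =
  trans (count-++ p (f x) (concatMap f xs)) (cong (count p (f x) +_) (count-concatMap p f xs))

count-cong : (xs : List A) → (∀ {x} → x ∈ xs → p x ≡ q x) → count p xs ≡ count q xs
count-cong []       eq = refl
count-cong (x ∷ xs) eq = cong₂ _+_ (cong indicator (eq (here refl))) (count-cong xs (eq ∘ there))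

indicator-mono : ∀ {a b} → (T a → T b) → indicator a ≤ indicator b
indicator-mono {true}  {true}  _ = ≤-refl
indicator-mono {true}  {false} f = ⊥-elim (f _)
indicator-mono {false}         _ = z≤n

indicator-< : ∀ {a b} → ¬ T a → T b → indicator a < indicator b
indicator-< {false} {true} _ _ = s≤s z≤n
indicator-< {true}         ¬a _ = ⊥-elim (¬a _)

count-mono : (xs : List A) → (∀ {x} → x ∈ xs → T (p x) → T (q x)) → count p xs ≤ count q xs
count-mono []       p⇒q = z≤n
count-mono (x ∷ xs) p⇒q = +-mono-≤ (indicator-mono (p⇒q (here refl))) (count-mono xs (p⇒q ∘ there))

count-< : (∀ {x} → x ∈ xs → T (p x) → T (q x)) → y ∈ xs → ¬ T (p y) → T (q y) → count p xs < count q xs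
count-< {xs = _ ∷ xs} p⇒q (here refl) ¬py qy = +-mono-<-≤ (indicator-< ¬py qy) (count-mono xs (p⇒q ∘ there))
count-< p⇒q (there y∈xs) ¬py qy =
  +-mono-≤-< (indicator-mono (p⇒q (here refl))) (count-< (p⇒q ∘ there) y∈xs ¬py qy)

count-true : (xs : List A) → count (λ _ → true) xs ≡ length xs
count-true []       = refl
count-true (x ∷ xs) = cong suc (count-true xs)

count-false : (xs : List A) → count (λ _ → false) xs ≡ 0
count-false []       = refl
count-false (x ∷ xs) = count-false xs

count-split : (p q : A → Bool) (xs : List A) →
              count p xs ≡ count (λ x → p x ∧ q x) xs + count (λ x → p x ∧ not (q x)) xs
count-split p q []       = refl
count-split p q (x ∷ xs) = trans (cong (indicator (p x) +_) (count-split p q xs)) (split (p x) (q x))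
  where
  split : ∀ a b {m n} → indicator a + (m + n) ≡ (indicator (a ∧ b) + m) + (indicator (a ∧ not b) + n)
  split true  true          = refl
  split true  false {m} {n} = sym (+-suc m n)
  split false b             = refl

count-const-∧ : (b : Bool) (p : A → Bool) (xs : List A) → count (λ x → b ∧ p x) xs ≡ indicator b * count p xs
count-const-∧ true  p xs = sym (+-identityʳ _)
count-const-∧ false p xs = count-false xs

count-↭ : (p : A → Bool) → xs ↭ ys → count p xs ≡ count p ys
count-↭ {xs = xs} {ys} p xs↭ys = begin
  count p xs                          ≡⟨ length-filter≡count p xs ⟨
  length (filter (T? ∘ p) xs)         ≡⟨ ↭-length (filter-↭ (T? ∘ p) xs↭ys) ⟩
  length (filter (T? ∘ p) ys)         ≡⟨ length-filter≡count p ys ⟩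
  count p ys                          ∎
  where open ≡-Reasoning

sum-indicator : (p : A → Bool) (k : ℕ) (xs : List A) → sum (map (λ x → indicator (p x) * k) xs) ≡ count p xs * k
sum-indicator p k []       = refl
sum-indicator p k (x ∷ xs) =
  trans (cong (indicator (p x) * k +_) (sum-indicator p k xs)) (sym (*-distribʳ-+ k (indicator (p x)) (count p xs)))

sum-map-const : (f : A → ℕ) (k : ℕ) (xs : List A) → (∀ {x} → x ∈ xs → f x ≡ k) → sum (map f xs) ≡ length xs * k
sum-map-const f k []       _ = refl
sum-map-const f k (x ∷ xs) f≡k = cong₂ _+_ (f≡k (here refl)) (sum-map-const f k xs (f≡k ∘ there))

sum-upTo-suc : (f : ℕ → ℕ) (n : ℕ) → sum (map f (upTo (suc n))) ≡ f 0 + sum (map (f ∘ suc) (upTo n))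
sum-upTo-suc f n = cong (λ l → f 0 + sum l) (trans (map-applyUpTo suc f n) (sym (map-upTo (f ∘ suc) n)))

sum-upTo-∷ʳ : (f : ℕ → ℕ) (n : ℕ) → sum (map f (upTo (suc n))) ≡ sum (map f (upTo n)) + f n
sum-upTo-∷ʳ f n = begin
  sum (map f (upTo (suc n)))         ≡⟨ cong (sum ∘ map f) (upTo-∷ʳ n) ⟨
  sum (map f (upTo n ++ n ∷ []))     ≡⟨ cong sum (map-++ f (upTo n) (n ∷ [])) ⟩
  sum (map f (upTo n) ++ f n ∷ [])   ≡⟨ sum-++ (map f (upTo n)) (f n ∷ []) ⟩
  sum (map f (upTo n)) + (f n + 0)   ≡⟨ cong (sum (map f (upTo n)) +_) (+-identityʳ (f n)) ⟩
  sum (map f (upTo n)) + f n         ∎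
  where open ≡-Reasoning

sum-map-cong : {f g : A → ℕ} (xs : List A) → (∀ {x} → x ∈ xs → f x ≡ g x) → sum (map f xs) ≡ sum (map g xs)
sum-map-cong xs f≡g = cong sum (map-cong-local (All.tabulate f≡g))

Unique-resp-↭ : {A : Set} {xs ys : List A} → xs ↭ ys → Unique xs → Unique ys
Unique-resp-↭ {A = A} xs↭ys = PermSetoid.Unique-resp-↭ (setoid A) (↭⇒↭ₛ xs↭ys)

Unique-map⁺-on : (f : A → B) → Unique xs → (∀ {x y} → x ∈ xs → y ∈ xs → f x ≡ f y → x ≡ y) → Unique (map f xs)
Unique-map⁺-on {xs = []}     f _          _   = []
Unique-map⁺-on {xs = x ∷ xs} f (x∉ ∷ uxs) inj =
  All.tabulate fresh ∷ Unique-map⁺-on f uxs (λ x∈ y∈ → inj (there x∈) (there y∈))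
  where
  fresh : ∀ {z} → z ∈ map f xs → f x ≢ z
  fresh z∈ fx≡z with ∈-map⁻ f z∈
  ... | y , y∈ , refl = All.lookup x∉ y∈ (inj (here refl) (there y∈) fx≡z)

∈⇒↭-∷ : x ∈ ys → ∃ λ ys′ → (ys ↭ x ∷ ys′) × (∀ {y} → y ∈ ys → y ≢ x → y ∈ ys′)
∈⇒↭-∷ {x = x} x∈ys with ∈-∃++ x∈ys
... | us , vs , refl = us ++ vs , shift x us vs , keep
  where
  keep : ∀ {y} → y ∈ us ++ x ∷ vs → y ≢ x → y ∈ us ++ vs
  keep y∈ y≢x with ∈-++⁻ us y∈
  ... | inj₁ y∈us          = ∈-++⁺ˡ y∈us
  ... | inj₂ (here y≡x)    = ⊥-elim (y≢x y≡x)
  ... | inj₂ (there y∈vs)  = ∈-++⁺ʳ us y∈vs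

Unique-⊆⇒↭-++ : Unique xs → xs ⊆ ys → ∃ λ zs → ys ↭ xs ++ zs
Unique-⊆⇒↭-++ {xs = []}     {ys} _          _     = ys , ↭-refl
Unique-⊆⇒↭-++ {xs = x ∷ xs}      (x∉ ∷ uxs) xs⊆ys with ∈⇒↭-∷ (xs⊆ys (here refl))
... | ys′ , ys↭ , keep with Unique-⊆⇒↭-++ uxs (λ y∈ → keep (xs⊆ys (there y∈)) (λ y≡x → All.lookup x∉ y∈ (sym y≡x)))
... | zs , ys′↭ = zs , ↭-trans ys↭ (↭-prep x ys′↭)

Unique-⊆⇒length≤ : Unique xs → xs ⊆ ys → length xs ≤ length ys
Unique-⊆⇒length≤ {xs = xs} uxs xs⊆ys with Unique-⊆⇒↭-++ uxs xs⊆ys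
... | zs , ys↭ = subst (length xs ≤_) (sym (trans (↭-length ys↭) (length-++ xs))) (m≤m+n _ _)

Unique-⊆-length≥⇒↭ : Unique xs → xs ⊆ ys → length ys ≤ length xs → ys ↭ xs
Unique-⊆-length≥⇒↭ {xs = xs} {ys = ys} uxs xs⊆ys ys≤xs with Unique-⊆⇒↭-++ uxs xs⊆ys
... | []     , ys↭ = ↭-trans ys↭ (↭-reflexive (++-identityʳ xs))
... | z ∷ zs , ys↭ = ⊥-elim (<⇒≱ xs<ys ys≤xs)
  where
  xs<ys : length xs < length ys
  xs<ys = subst (length xs <_) (sym (trans (↭-length ys↭) (length-++ xs))) (m<m+n (length xs) (s≤s z≤n))

at-map : (f : ℕ → ℕ) (xs : List ℕ) {i : ℕ} → i < length xs → at (map f xs) i ≡ f (at xs i)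
at-map f (x ∷ xs) {zero}  _         = refl
at-map f (x ∷ xs) {suc i} (s≤s i<) = at-map f xs i<

at-∈ : (xs : List ℕ) {i : ℕ} → i < length xs → at xs i ∈ xs
at-∈ (x ∷ xs) {zero}  _         = here refl
at-∈ (x ∷ xs) {suc i} (s≤s i<) = there (at-∈ xs i<)

∈⇒at : {x : ℕ} (xs : List ℕ) → x ∈ xs → ∃ λ i → i < length xs × at xs i ≡ x
∈⇒at (y ∷ xs) (here refl) = 0 , s≤s z≤n , refl
∈⇒at (y ∷ xs) (there x∈) with ∈⇒at xs x∈
... | i , i< , eq = suc i , s≤s i< , eq

at-All : {Q : ℕ → Set} {xs : List ℕ} → Q 0 → All Q xs → ∀ i → Q (at xs i)
at-All q0 []         i       = q0
at-All q0 (qx ∷ _)   zero    = qx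
at-All q0 (_ ∷ qxs)  (suc i) = at-All q0 qxs i

Unique⇒at-injective : (xs : List ℕ) → Unique xs → ∀ {i j} → i < length xs → j < length xs → at xs i ≡ at xs j → i ≡ j
Unique⇒at-injective (x ∷ xs) _          {zero}  {zero}  _        _        _  = refl
Unique⇒at-injective (x ∷ xs) (x∉ ∷ _)   {zero}  {suc j} _        (s≤s j<) eq = ⊥-elim (All.lookup x∉ (at-∈ xs j<) eq)
Unique⇒at-injective (x ∷ xs) (x∉ ∷ _)   {suc i} {zero}  (s≤s i<) _        eq = ⊥-elim (All.lookup x∉ (at-∈ xs i<) (sym eq))
Unique⇒at-injective (x ∷ xs) (_ ∷ uxs)  {suc i} {suc j} (s≤s i<) (s≤s j<) eq =
  cong suc (Unique⇒at-injective xs uxs i< j< eq)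

at-injective⇒Unique : (xs : List ℕ) → (∀ {i j} → i < length xs → j < length xs → at xs i ≡ at xs j → i ≡ j) → Unique xs
at-injective⇒Unique []       _   = []
at-injective⇒Unique (x ∷ xs) inj =
  All.tabulate (λ y∈ x≡y → let i , i< , eq = ∈⇒at xs y∈ in 0≢1+n (inj (s≤s z≤n) (s≤s i<) (trans x≡y (sym eq)))) ∷
  at-injective⇒Unique xs (λ i< j< eq → suc-injective (inj (s≤s i<) (s≤s j<) eq))

Vec-at-ext : {m : ℕ} (v w : Vec ℕ m) → (∀ {i} → i < m → at (toList v) i ≡ at (toList w) i) → v ≡ w
Vec-at-ext []      []      _  = refl
Vec-at-ext (x ∷ v) (y ∷ w) eq = cong₂ _∷_ (eq (s≤s z≤n)) (Vec-at-ext v w (λ i< → eq (s≤s i<)))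

count-grid-suc : {m : ℕ} (t : ℕ) (p : Vec ℕ (suc m) → Bool) →
                 count p (grid t (suc m)) ≡ sum (map (λ a → count (p ∘ (a ∷_)) (grid t m)) (upTo (suc t)))
count-grid-suc {m} t p =
  trans (count-concatMap p (λ a → map (a ∷_) (grid t m)) (upTo (suc t)))
        (sum-map-cong (upTo (suc t)) (λ {a} _ → count-map p (a ∷_) (grid t m)))

length-grid : (t m : ℕ) → length (grid t m) ≡ suc t ^ m
length-grid t m = trans (sym (count-true (grid t m))) (count-all m)
  where
  count-all : ∀ m → count (λ _ → true) (grid t m) ≡ suc t ^ m
  count-all zero    = refl
  count-all (suc m) = begin
    count (λ _ → true) (grid t (suc m))                                 ≡⟨ count-grid-suc {m} t (λ _ → true) ⟩
    sum (map (λ _ → count (λ _ → true) (grid t m)) (upTo (suc t)))      ≡⟨ sum-map-const _ _ (upTo (suc t)) (λ _ → count-all m) ⟩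
    length (upTo (suc t)) * suc t ^ m                                   ≡⟨ cong (_* suc t ^ m) (length-upTo (suc t)) ⟩
    suc t * suc t ^ m                                                   ∎
    where open ≡-Reasoning

grid-unique : (t m : ℕ) → Unique (grid t m)
grid-unique t zero    = [] ∷ []
grid-unique t (suc m) = rows (upTo (suc t)) (UniqueP.upTo⁺ (suc t))
  where
  row : ℕ → List (Vec ℕ (suc m))
  row a = map (a ∷_) (grid t m)
  rows : ∀ as → Unique as → Unique (concatMap row as)
  rows []       _          = []
  rows (a ∷ as) (a∉ ∷ uas) = UniqueP.++⁺ (UniqueP.map⁺ ∷-injectiveʳ (grid-unique t m)) (rows as uas) disjoint
    where
    disjoint : ∀ {v} → ¬ (v ∈ row a × v ∈ concatMap row as)
    disjoint (v∈a , v∈as) with ∈-map⁻ (a ∷_) v∈a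
    ... | w , _ , refl = elsewhere a∉ (∈-concatMap⁻ row {xs = as} v∈as)
      where
      elsewhere : ∀ {bs} → All (a ≢_) bs → Any (λ b → (a ∷ w) ∈ row b) bs → ⊥
      elsewhere (a≢b ∷ _) (here aw∈b) with ∈-map⁻ _ aw∈b
      ... | _ , _ , refl = a≢b refl
      elsewhere (_ ∷ a∉bs) (there aw∈bs) = elsewhere a∉bs aw∈bs

∈-grid⁺ : (t : ℕ) {m : ℕ} (v : Vec ℕ m) → All (_≤ t) (toList v) → v ∈ grid t m
∈-grid⁺ t []      _            = here refl
∈-grid⁺ t {suc m} (a ∷ v) (a≤t ∷ v≤t) = ∈-concatMap⁺ (λ a → map (a ∷_) (grid t m)) {xs = upTo (suc t)}
  (Any.map (λ { refl → ∈-map⁺ (a ∷_) (∈-grid⁺ t v v≤t) }) (∈-upTo⁺ (s≤s a≤t)))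

∈-grid⁻ : (t : ℕ) {m : ℕ} (v : Vec ℕ m) → v ∈ grid t m → All (_≤ t) (toList v)
∈-grid⁻ t []      _   = []
∈-grid⁻ t {suc m} (a ∷ v) v∈ with find (∈-concatMap⁻ (λ b → map (b ∷_) (grid t m)) {xs = upTo (suc t)} v∈)
... | b , b∈ , v∈row with ∈-map⁻ (b ∷_) v∈row
... | w , w∈ , refl = ≤-pred (∈-upTo⁻ b∈) ∷ ∈-grid⁻ t w w∈

count-grid-restrict : (t m : ℕ) (p : Vec ℕ m → Bool) →
                      count (λ z → p z ∧ all (_≤ᵇ t) (toList z)) (grid (suc t) m) ≡ count p (grid t m)
count-grid-restrict t zero    p = cong (_+ 0) (cong indicator (∧-identityʳ (p [])))
count-grid-restrict t (suc m) p = begin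
  count (λ z → p z ∧ below z) (grid (suc t) (suc m))   ≡⟨ count-grid-suc {m} (suc t) (λ z → p z ∧ below z) ⟩
  sum (map F (upTo (suc (suc t))))                     ≡⟨ sum-upTo-∷ʳ F (suc t) ⟩
  sum (map F (upTo (suc t))) + F (suc t)               ≡⟨ cong (sum (map F (upTo (suc t))) +_) top-row ⟩
  sum (map F (upTo (suc t))) + 0                       ≡⟨ +-identityʳ _ ⟩
  sum (map F (upTo (suc t)))                           ≡⟨ sum-map-cong (upTo (suc t)) lower-row ⟩
  sum (map (λ a → count (p ∘ (a ∷_)) (grid t m)) (upTo (suc t))) ≡⟨ count-grid-suc {m} t p ⟨
  count p (grid t (suc m))                             ∎
  where
  open ≡-Reasoning
  below : {k : ℕ} → Vec ℕ k → Bool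
  below z = all (_≤ᵇ t) (toList z)
  F : ℕ → ℕ
  F a = count (λ v → p (a ∷ v) ∧ below (a ∷ v)) (grid (suc t) m)
  top-row : F (suc t) ≡ 0
  top-row = trans (count-cong (grid (suc t) m) (λ {v} _ → too-big v)) (count-false (grid (suc t) m))
    where
    too-big : ∀ v → (p (suc t ∷ v) ∧ below (suc t ∷ v)) ≡ false
    too-big v = trans (cong (λ b → p (suc t ∷ v) ∧ (b ∧ below v)) (¬T⇒≡false (<⇒≱ ≤-refl ∘ ≤ᵇ⇒≤ (suc t) t)))
                      (∧-zeroʳ (p (suc t ∷ v)))
  lower-row : ∀ {a} → a ∈ upTo (suc t) → F a ≡ count (p ∘ (a ∷_)) (grid t m)
  lower-row {a} a∈ = trans (count-cong (grid (suc t) m) (λ {v} _ → cong (λ b → p (a ∷ v) ∧ (b ∧ below v)) a≤t))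
                           (count-grid-restrict t m (p ∘ (a ∷_)))
    where
    a≤t : (a ≤ᵇ t) ≡ true
    a≤t = T⇒≡true (≤⇒≤ᵇ (≤-pred (∈-upTo⁻ a∈)))

-- Binomial coefficients and falling factorials

P≡P′ : ∀ {n k} → k ≤ n → n P k ≡ n P′ k
P≡P′ k≤n = trans (nPk≡n!/[n∸k]! k≤n) (sym (nP′k≡n!/[n∸k]! k≤n))

P-suc : ∀ n k → n P suc k ≡ n * ((n ∸ 1) P k)
P-suc zero    k = refl
P-suc (suc n) k with k ≤? n
... | yes k≤n = begin
  suc n P suc k        ≡⟨ P≡P′ (s≤s k≤n) ⟩
  suc n P′ suc k       ≡⟨ nP′k≡n[n∸1P′k∸1] (suc n) (suc k) ⟩
  suc n * (n P′ k)     ≡⟨ cong (suc n *_) (P≡P′ k≤n) ⟨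
  suc n * (n P k)      ∎
  where open ≡-Reasoning
... | no k≰n = trans (k>n⇒nPk≡0 (s≤s (≰⇒> k≰n))) (sym (trans (cong (suc n *_) (k>n⇒nPk≡0 (≰⇒> k≰n))) (*-zeroʳ (suc n))))

k!*nCk≡nPk : ∀ n k → k ! * (n C k) ≡ n P k
k!*nCk≡nPk n k with k ≤? n
... | yes k≤n = begin
  k ! * (n C k)          ≡⟨ cong (k ! *_) (nCk≡nPk/k! k≤n) ⟩
  k ! * ((n P k) / k !)  ≡⟨ m*[n/m]≡n (subst (k ! ∣_) (sym (P≡P′ k≤n)) (k!∣nP′k k≤n)) ⟩
  n P k                  ∎
  where open ≡-Reasoning; instance _ = k !≢0
... | no k≰n = trans (cong (k ! *_) (k>n⇒nCk≡0 (≰⇒> k≰n))) (trans (*-zeroʳ (k !)) (sym (k>n⇒nPk≡0 (≰⇒> k≰n))))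

P≤^ : ∀ n k → n P k ≤ n ^ k
P≤^ n zero    = ≤-refl
P≤^ n (suc k) = begin
  n P suc k          ≡⟨ P-suc n k ⟩
  n * ((n ∸ 1) P k)  ≤⟨ *-monoʳ-≤ n (P≤^ (n ∸ 1) k) ⟩
  n * (n ∸ 1) ^ k    ≤⟨ *-monoʳ-≤ n (^-monoˡ-≤ k (m∸n≤m n 1)) ⟩
  n * n ^ k          ∎
  where open ≤-Reasoning

sum-C-upTo : ∀ m t → sum (map (λ a → (t ∸ suc a) C m) (upTo t)) ≡ t C suc m
sum-C-upTo m zero    = refl
sum-C-upTo m (suc t) = begin
  sum (map (λ a → (suc t ∸ suc a) C m) (upTo (suc t)))  ≡⟨ sum-upTo-suc (λ a → (t ∸ a) C m) t ⟩
  t C m + sum (map (λ a → (t ∸ suc a) C m) (upTo t))    ≡⟨ cong (t C m +_) (sum-C-upTo m t) ⟩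
  t C m + t C suc m                                      ≡⟨ nCk+nC[k+1]≡[n+1]C[k+1] t m ⟩
  suc t C suc m                                          ∎
  where open ≡-Reasoning

hockey-stick : ∀ m ℓ t → sum (map (λ a → indicator (ℓ <ᵇ a) * ((t ∸ a) C m)) (upTo (suc t))) ≡ (t ∸ ℓ) C suc m
hockey-stick m zero t = begin
  sum (map (λ a → indicator (0 <ᵇ a) * ((t ∸ a) C m)) (upTo (suc t)))  ≡⟨ sum-upTo-suc (λ a → indicator (0 <ᵇ a) * ((t ∸ a) C m)) t ⟩
  sum (map (λ a → 1 * ((t ∸ suc a) C m)) (upTo t))                     ≡⟨ sum-map-cong (upTo t) (λ _ → *-identityˡ _) ⟩
  sum (map (λ a → (t ∸ suc a) C m) (upTo t))                           ≡⟨ sum-C-upTo m t ⟩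
  t C suc m                                                            ∎
  where open ≡-Reasoning
hockey-stick m (suc ℓ) zero    = refl
hockey-stick m (suc ℓ) (suc t) = trans (sum-upTo-suc (λ a → indicator (suc ℓ <ᵇ a) * ((suc t ∸ a) C m)) (suc t)) (hockey-stick m ℓ t)

fallingConst : ℕ → ℕ → ℕ
fallingConst d zero    = d
fallingConst d (suc m) = d + fallingConst (suc d) m

^-P-gap : ∀ m N d → (N + d) ^ suc m ≤ N P suc m + fallingConst d m * (N + d) ^ m
^-P-gap zero    N       d = ≤-reflexive (trans (*-identityʳ (N + d)) (cong₂ _+_ (sym (nP1≡n N)) (sym (*-identityʳ d))))
^-P-gap (suc m) zero    d = *-monoˡ-≤ (d ^ suc m) (m≤m+n d (fallingConst (suc d) m))
^-P-gap (suc m) (suc N) d = begin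
  Y * Y ^ suc m                               ≤⟨ *-monoʳ-≤ Y shifted ⟩
  Y * (F + K * Y ^ m)                         ≡⟨ solve 4 (λ Y F K Z → Y :* (F :+ K :* Z) := Y :* F :+ K :* (Y :* Z)) refl Y F K (Y ^ m) ⟩
  Y * F + K * Y ^ suc m                       ≡⟨ cong (_+ K * Y ^ suc m) (*-distribʳ-+ F (suc N) d) ⟩
  suc N * F + d * F + K * Y ^ suc m           ≤⟨ +-monoˡ-≤ (K * Y ^ suc m) (+-monoʳ-≤ (suc N * F) (*-monoʳ-≤ d F≤Y^)) ⟩
  suc N * F + d * Y ^ suc m + K * Y ^ suc m   ≡⟨ solve 4 (λ a b c Z → a :+ b :* Z :+ c :* Z := a :+ (b :+ c) :* Z) refl (suc N * F) d K (Y ^ suc m) ⟩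
  suc N * F + (d + K) * Y ^ suc m             ≡⟨ cong (_+ (d + K) * Y ^ suc m) (P-suc (suc N) (suc m)) ⟨
  suc N P suc (suc m) + (d + K) * Y ^ suc m   ∎
  where
  open ≤-Reasoning
  Y F K : ℕ
  Y = suc N + d
  F = N P suc m
  K = fallingConst (suc d) m
  shifted : Y ^ suc m ≤ F + K * Y ^ m
  shifted = subst (λ y → y ^ suc m ≤ F + K * y ^ m) (+-suc N d) (^-P-gap m N (suc d))
  F≤Y^ : F ≤ Y ^ suc m
  F≤Y^ = ≤-trans (P≤^ N (suc m)) (^-monoˡ-≤ (suc m) (≤-trans (n≤1+n N) (m≤m+n (suc N) d)))

-- Cyclic differences of residues

diffMod : ℕ → ℕ → ℕ → ℕ
diffMod T c r = if r <ᵇ c then T + r ∸ c else r ∸ c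

diffMod-+ : ∀ T c r → c ≤ T → diffMod T c r + c ≡ r + T * indicator (r <ᵇ c)
diffMod-+ T c r c≤T with r <? c
... | yes r<c rewrite T⇒≡true (<⇒<ᵇ r<c) = begin
  T + r ∸ c + c  ≡⟨ m∸n+n≡m (≤-trans c≤T (m≤m+n T r)) ⟩
  T + r          ≡⟨ +-comm T r ⟩
  r + T          ≡⟨ cong (r +_) (*-identityʳ T) ⟨
  r + T * 1      ∎
  where open ≡-Reasoning
... | no r≮c rewrite ¬T⇒≡false (r≮c ∘ <ᵇ⇒< r c) = begin
  r ∸ c + c      ≡⟨ m∸n+n≡m (≮⇒≥ r≮c) ⟩
  r              ≡⟨ +-identityʳ r ⟨
  r + 0          ≡⟨ cong (r +_) (*-zeroʳ T) ⟨
  r + T * 0      ∎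
  where open ≡-Reasoning

diffMod-< : ∀ {T c r} → c < T → r < T → diffMod T c r < T
diffMod-< {T} {c} {r} c<T r<T with r <? c
... | yes r<c rewrite T⇒≡true (<⇒<ᵇ r<c) =
  +-cancelʳ-< c (T + r ∸ c) T (subst (_< T + c) (sym (m∸n+n≡m (≤-trans (<⇒≤ c<T) (m≤m+n T r)))) (+-monoʳ-< T r<c))
... | no r≮c rewrite ¬T⇒≡false (r≮c ∘ <ᵇ⇒< r c) = ≤-<-trans (m∸n≤m r c) r<T

diffMod-injective : ∀ {T c r r′} → c ≤ T → r < T → r′ < T → diffMod T c r ≡ diffMod T c r′ → r ≡ r′
diffMod-injective {T} {c} {r} {r′} c≤T r<T r′<T eq = cancel (r <ᵇ c) (r′ <ᵇ c) r<T r′<T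
  (trans (sym (diffMod-+ T c r c≤T)) (trans (cong (_+ c) eq) (diffMod-+ T c r′ c≤T)))
  where
  cancel : ∀ {a b} u v → a < T → b < T → a + T * indicator u ≡ b + T * indicator v → a ≡ b
  cancel true  true  _   _   e = +-cancelʳ-≡ (T * 1) _ _ e
  cancel false false _   _   e = +-cancelʳ-≡ (T * 0) _ _ e
  cancel {a} {b} true  false _   b<T e = ⊥-elim (<⇒≱ b<T (subst (T ≤_) (a+T≡b a b e) (m≤n+m T a)))
    where
    a+T≡b : ∀ a b → a + T * 1 ≡ b + T * 0 → a + T ≡ b
    a+T≡b a b e = trans (cong (a +_) (sym (*-identityʳ T))) (trans e (trans (cong (b +_) (*-zeroʳ T)) (+-identityʳ b)))
  cancel false true  a<T b<T e = sym (cancel true false b<T a<T (sym e))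

diffsMod : {m : ℕ} → ℕ → ℕ → Vec ℕ m → Vec ℕ m
diffsMod T c []       = []
diffsMod T c (r ∷ rs) = diffMod T c r ∷ diffsMod T r rs

diffsMod-injective : ∀ {T c m} {v w : Vec ℕ m} → c < T → All (_< T) (toList v) → All (_< T) (toList w) →
                     diffsMod T c v ≡ diffsMod T c w → v ≡ w
diffsMod-injective {v = []}    {[]}    _   _            _            _  = refl
diffsMod-injective {v = x ∷ v} {y ∷ w} c<T (x<T ∷ v<T) (y<T ∷ w<T) eq
  with refl ← diffMod-injective (<⇒≤ c<T) x<T y<T (∷-injectiveˡ eq)
  = cong (x ∷_) (diffsMod-injective x<T v<T w<T (∷-injectiveʳ eq))

diffsMod-< : ∀ {T c m} (v : Vec ℕ m) → c < T → All (_< T) (toList v) → All (_< T) (toList (diffsMod T c v))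
diffsMod-< []      _   _            = []
diffsMod-< (x ∷ v) c<T (x<T ∷ v<T) = diffMod-< c<T x<T ∷ diffsMod-< v x<T v<T

prefixed : {m : ℕ} → ℕ → Vec ℕ m → ℕ → ℕ
prefixed c v zero    = c
prefixed c v (suc p) = at (toList v) p

at-diffsMod : ∀ {T c m} (v : Vec ℕ m) {i} → i < m →
              at (toList (diffsMod T c v)) i ≡ diffMod T (prefixed c v i) (prefixed c v (suc i))
at-diffsMod (x ∷ v) {zero}                  _        = refl
at-diffsMod {T} (x ∷ v) {suc zero}    (s≤s i<) = at-diffsMod {T} v i<
at-diffsMod {T} (x ∷ v) {suc (suc i)} (s≤s i<) = at-diffsMod {T} v i<

at-diffsMod-0 : ∀ {T m} (v : Vec ℕ m) {i} → i < m → at (toList (diffsMod T 0 v)) i ≡ diffMod T (wseq v i) (wseq v (suc i))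
at-diffsMod-0 v {zero}  i< = at-diffsMod v i<
at-diffsMod-0 v {suc i} i< = at-diffsMod v i<

-- Partial sums of the cyclic differences telescope, and every wrap-around is a descent of the residues.
partSum-diffsMod : ∀ {T m} (r : Vec ℕ m) → 0 < T → All (_< T) (toList r) → ∀ len i → i + len ≤ m →
  partSum (toList (diffsMod T 0 r)) i len + wseq r i ≡ wseq r (i + len) + T * descFrom (wseq r) i len
partSum-diffsMod {T} r 0<T r<T zero    i _ = begin
  wseq r i                      ≡⟨ cong (wseq r) (+-identityʳ i) ⟨
  wseq r (i + 0)                ≡⟨ +-identityʳ _ ⟨
  wseq r (i + 0) + 0            ≡⟨ cong (wseq r (i + 0) +_) (*-zeroʳ T) ⟨
  wseq r (i + 0) + T * 0        ∎
  where open ≡-Reasoning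
partSum-diffsMod {T} {m} r 0<T r<T (suc len) i i+len<m = begin
  (a + rest) + s i                 ≡⟨ solve 3 (λ a p s → (a :+ p) :+ s := (a :+ s) :+ p) refl a rest (s i) ⟩
  (a + s i) + rest                 ≡⟨ cong (_+ rest) step ⟩
  s (suc i) + T * e + rest         ≡⟨ solve 4 (λ x T e p → x :+ T :* e :+ p := (p :+ x) :+ T :* e) refl (s (suc i)) T e rest ⟩
  (rest + s (suc i)) + T * e       ≡⟨ cong (_+ T * e) (partSum-diffsMod r 0<T r<T len (suc i) (subst (_≤ m) (+-suc i len) i+len<m)) ⟩
  s (suc i + len) + T * D + T * e  ≡⟨ solve 4 (λ x T D e → x :+ T :* D :+ T :* e := x :+ T :* (e :+ D)) refl (s (suc i + len)) T D e ⟩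
  s (suc i + len) + T * (e + D)    ≡⟨ cong (λ k → s k + T * (e + D)) (+-suc i len) ⟨
  s (i + suc len) + T * (e + D)    ∎
  where
  open ≡-Reasoning
  s : ℕ → ℕ
  s = wseq r
  a rest e D : ℕ
  a = at (toList (diffsMod T 0 r)) i
  rest = partSum (toList (diffsMod T 0 r)) (suc i) len
  e = indicator (s (suc i) <ᵇ s i)
  D = descFrom s (suc i) len
  s<T : ∀ p → s p < T
  s<T zero    = 0<T
  s<T (suc p) = at-All 0<T r<T p
  step : a + s i ≡ s (suc i) + T * e
  step = trans (cong (_+ s i) (at-diffsMod-0 r (≤-trans (s≤s (m≤m+n i len)) (subst (_≤ m) (+-suc i len) i+len<m))))
               (diffMod-+ T (s i) (s (suc i)) (<⇒≤ (s<T i)))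

grid-< : ∀ {t m} {v : Vec ℕ m} → v ∈ grid t m → All (_< suc t) (toList v)
grid-< {v = v} v∈ = All.map s≤s (∈-grid⁻ _ v v∈)

count-diffsMod : (t m : ℕ) (p : Vec ℕ m → Bool) → count p (grid t m) ≡ count (p ∘ diffsMod (suc t) 0) (grid t m)
count-diffsMod t m p = trans (count-↭ p grid↭) (count-map p ψ (grid t m))
  where
  ψ : Vec ℕ m → Vec ℕ m
  ψ = diffsMod (suc t) 0
  grid↭ : grid t m ↭ map ψ (grid t m)
  grid↭ = Unique-⊆-length≥⇒↭
    (Unique-map⁺-on ψ (grid-unique t m) (λ v∈ w∈ → diffsMod-injective (s≤s z≤n) (grid-< v∈) (grid-< w∈)))
    (λ ψv∈ → let v , v∈ , eq = ∈-map⁻ ψ ψv∈ in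
             subst (_∈ grid t m) (sym eq) (∈-grid⁺ t (ψ v) (All.map ≤-pred (diffsMod-< v (s≤s z≤n) (grid-< v∈)))))
    (≤-reflexive (sym (length-map ψ (grid t m))))

-- Generic residue vectors and their ranks

T⇔T⇒≡ : ∀ {a b} → (T a → T b) → (T b → T a) → a ≡ b
T⇔T⇒≡ {true}  {true}  _ _ = refl
T⇔T⇒≡ {true}  {false} f _ = ⊥-elim (f _)
T⇔T⇒≡ {false} {true}  _ g = ⊥-elim (g _)
T⇔T⇒≡ {false} {false} _ _ = refl

distinctOutside : List ℕ → List ℕ → Bool
distinctOutside E []       = true
distinctOutside E (x ∷ xs) = not (does (x ∈? E)) ∧ distinctOutside (x ∷ E) xs

distinctOutside-sound : ∀ E xs → T (distinctOutside E xs) → Unique xs × All (_∉ E) xs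
distinctOutside-sound E []       _ = [] , []
distinctOutside-sound E (x ∷ xs) h with x ∈? E | h
... | no x∉E | h′ with distinctOutside-sound (x ∷ E) xs h′
...   | uxs , xs∉ = All.map (λ y∉ x≡y → y∉ (here (sym x≡y))) xs∉ ∷ uxs , x∉E ∷ All.map (_∘ there) xs∉

distinctOutside-complete : ∀ E xs → Unique xs → All (_∉ E) xs → T (distinctOutside E xs)
distinctOutside-complete E []       _          _          = _
distinctOutside-complete E (x ∷ xs) (x∉xs ∷ uxs) (x∉E ∷ xs∉E) with x ∈? E
... | yes x∈E = x∉E x∈E
... | no  _   = distinctOutside-complete (x ∷ E) xs uxs
                  (All.zipWith (λ (x≢y , y∉E) → λ { (here y≡x) → x≢y (sym y≡x) ; (there y∈E) → y∉E y∈E }) (x∉xs , xs∉E))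

generic : {m : ℕ} → Vec ℕ m → Bool
generic v = distinctOutside (0 ∷ []) (toList v)

generic⇒Unique : {m : ℕ} (v : Vec ℕ m) → T (generic v) → Unique (0 ∷ toList v)
generic⇒Unique v g with distinctOutside-sound (0 ∷ []) (toList v) g
... | uv , v∉0 = All.map (λ y∉0 0≡y → y∉0 (here (sym 0≡y))) v∉0 ∷ uv

Unique⇒generic : {m : ℕ} (v : Vec ℕ m) → Unique (0 ∷ toList v) → T (generic v)
Unique⇒generic v (0∉v ∷ uv) =
  distinctOutside-complete (0 ∷ []) (toList v) uv (All.map (λ 0≢y → λ { (here y≡0) → 0≢y (sym y≡0) }) 0∉v)

wseq≡at : {m : ℕ} (v : Vec ℕ m) (i : ℕ) → wseq v i ≡ at (0 ∷ toList v) i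
wseq≡at v zero    = refl
wseq≡at v (suc i) = refl

generic-wseq-injective : {m : ℕ} (v : Vec ℕ m) → T (generic v) → ∀ {i j} → i ≤ m → j ≤ m → wseq v i ≡ wseq v j → i ≡ j
generic-wseq-injective {m} v g {i} {j} i≤m j≤m eq =
  Unique⇒at-injective (0 ∷ toList v) (generic⇒Unique v g) (s≤s (≤-trans i≤m m≤len)) (s≤s (≤-trans j≤m m≤len))
    (trans (sym (wseq≡at v i)) (trans eq (wseq≡at v j)))
  where
  m≤len : m ≤ length (toList v)
  m≤len = ≤-reflexive (sym (length-toList v))

generic-positive : {m : ℕ} (v : Vec ℕ m) → T (generic v) → ∀ {i} → suc i ≤ m → 0 < wseq v (suc i)
generic-positive v g {i} i<m with wseq v (suc i) in eq
... | zero  = ⊥-elim (0≢1+n (generic-wseq-injective v g z≤n i<m (sym eq)))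
... | suc _ = s≤s z≤n

rankIn : List ℕ → ℕ → ℕ
rankIn L x = suc (count (_<ᵇ x) L)

rank : {m : ℕ} → Vec ℕ m → Vec ℕ m
rank v = Vec.map (rankIn (toList v)) v

rankIn-<⇔ : ∀ L {x y} → x ∈ L → rankIn L x < rankIn L y ⇔ x < y
rankIn-<⇔ L {x} {y} x∈L = mk⇔ reflect preserve
  where
  preserve : x < y → rankIn L x < rankIn L y
  preserve x<y = s≤s (count-< (λ _ z<x → <⇒<ᵇ (<-trans (<ᵇ⇒< _ _ z<x) x<y)) x∈L (<⇒≱ ≤-refl ∘ <ᵇ⇒< x x) (<⇒<ᵇ x<y))
  reflect : rankIn L x < rankIn L y → x < y
  reflect r< with x <? y
  ... | yes x<y = x<y
  ... | no  x≮y = ⊥-elim (<⇒≱ r< (s≤s (count-mono L (λ _ z<y → <⇒<ᵇ (<-≤-trans (<ᵇ⇒< _ _ z<y) (≮⇒≥ x≮y))))))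

at-rank : {m : ℕ} (v : Vec ℕ m) {i : ℕ} → i < m → at (toList (rank v)) i ≡ rankIn (toList v) (at (toList v) i)
at-rank v i<m = trans (cong (λ l → at l _) (toList-map (rankIn (toList v)) v))
                      (at-map (rankIn (toList v)) (toList v) (subst (_ <_) (sym (length-toList v)) i<m))

wseq-rank-<⇔ : {m : ℕ} (v : Vec ℕ m) → T (generic v) → ∀ {i j} → i ≤ m → j ≤ m →
               wseq (rank v) i < wseq (rank v) j ⇔ wseq v i < wseq v j
wseq-rank-<⇔ v g {zero}  {zero}  _   _   = mk⇔ id id
wseq-rank-<⇔ v g {zero}  {suc j} _   j≤m = mk⇔ (λ _ → generic-positive v g j≤m) (λ _ → subst (0 <_) (sym (at-rank v j≤m)) (s≤s z≤n))
wseq-rank-<⇔ v g {suc i} {zero}  _   _   = mk⇔ (λ ()) (λ ())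
wseq-rank-<⇔ v g {suc i} {suc j} i≤m j≤m =
  subst₂ (λ a b → a < b ⇔ wseq v (suc i) < wseq v (suc j)) (sym (at-rank v i≤m)) (sym (at-rank v j≤m))
         (rankIn-<⇔ (toList v) (at-∈ (toList v) (subst (_ <_) (sym (length-toList v)) i≤m)))

wseq-rank-<ᵇ : {m : ℕ} (v : Vec ℕ m) → T (generic v) → ∀ {i j} → i ≤ m → j ≤ m →
               (wseq (rank v) i <ᵇ wseq (rank v) j) ≡ (wseq v i <ᵇ wseq v j)
wseq-rank-<ᵇ v g {i} {j} i≤m j≤m =
  T⇔T⇒≡ (<⇒<ᵇ ∘ Equivalence.to ord ∘ <ᵇ⇒< _ _) (<⇒<ᵇ ∘ Equivalence.from ord ∘ <ᵇ⇒< _ _)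
  where
  ord : wseq (rank v) i < wseq (rank v) j ⇔ wseq v i < wseq v j
  ord = wseq-rank-<⇔ v g i≤m j≤m

descFrom-cong : ∀ (s s′ : ℕ → ℕ) i len → (∀ {p} → p < i + len → (s (suc p) <ᵇ s p) ≡ (s′ (suc p) <ᵇ s′ p)) →
                descFrom s i len ≡ descFrom s′ i len
descFrom-cong s s′ i zero      _  = refl
descFrom-cong s s′ i (suc len) eq =
  cong₂ _+_ (cong indicator (eq (subst (i <_) (sym (+-suc i len)) (s≤s (m≤m+n i len)))))
            (descFrom-cong s s′ (suc i) len (λ {p} p< → eq (subst (p <_) (sym (+-suc i len)) p<)))

descFrom-rank : {m : ℕ} (v : Vec ℕ m) → T (generic v) → ∀ i len → i + len ≤ m →
                descFrom (wseq (rank v)) i len ≡ descFrom (wseq v) i len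
descFrom-rank v g i len i+len≤m =
  descFrom-cong _ _ i len (λ p< → wseq-rank-<ᵇ v g (≤-trans p< i+len≤m) (≤-trans (<⇒≤ p<) i+len≤m))

rank-isPerm : {m : ℕ} (v : Vec ℕ m) → T (generic v) → IsPerm (rank v)
rank-isPerm {m} v g = subst (_↭ map suc (upTo m)) (sym (toList-map ρ v)) (↭-sym (Unique-⊆-length≥⇒↭ unique ⊆1…m length≥))
  where
  L : List ℕ
  L = toList v
  ρ : ℕ → ℕ
  ρ = rankIn L
  unique : Unique (map ρ L)
  unique with generic⇒Unique v g
  ... | _ ∷ uL = Unique-map⁺-on ρ uL injective
    where
    injective : ∀ {x y} → x ∈ L → y ∈ L → ρ x ≡ ρ y → x ≡ y
    injective {x} {y} x∈ y∈ eq with <-cmp x y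
    ... | tri< x<y _ _ = ⊥-elim (<-irrefl eq (Equivalence.from (rankIn-<⇔ L x∈) x<y))
    ... | tri≈ _ x≡y _ = x≡y
    ... | tri> _ _ y<x = ⊥-elim (<-irrefl (sym eq) (Equivalence.from (rankIn-<⇔ L y∈) y<x))
  ⊆1…m : map ρ L ⊆ map suc (upTo m)
  ⊆1…m ρy∈ with ∈-map⁻ ρ ρy∈
  ... | y , y∈ , refl = ∈-map⁺ suc (∈-upTo⁺ (subst (count (_<ᵇ y) L <_) (trans (count-true L) (length-toList v))
                           (count-< (λ _ _ → _) y∈ (<⇒≱ ≤-refl ∘ <ᵇ⇒< y y) _)))
  length≥ : length (map suc (upTo m)) ≤ length (map ρ L)
  length≥ = ≤-reflexive (trans (length-map suc (upTo m)) (trans (length-upTo m) (sym (trans (length-map ρ L) (length-toList v)))))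

-- The constraints of P in terms of descents

-- S + rᵢ ≡ rⱼ + T · D says S = T · D + (rⱼ − rᵢ) while avoiding truncated subtraction.
module _ {T S rᵢ rⱼ D : ℕ} (rᵢ<T : rᵢ < T) (rⱼ<T : rⱼ < T) (S≡ : S + rᵢ ≡ rⱼ + T * D) where

  open ≤-Reasoning

  multiple≤⇔ : rᵢ ≢ rⱼ → ∀ b → T * b ≤ S ⇔ (b ≤ D × (b ≡ D → rᵢ < rⱼ))
  multiple≤⇔ rᵢ≢rⱼ b = mk⇔ (λ Tb≤S → b≤D Tb≤S , b≡D⇒ Tb≤S) from
    where
    b≤D : T * b ≤ S → b ≤ D
    b≤D Tb≤S with b ≤? D
    ... | yes b≤D = b≤D
    ... | no  b≰D = ⊥-elim (<-irrefl refl (begin-strict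
      T * suc D     ≤⟨ *-monoʳ-≤ T (≰⇒> b≰D) ⟩
      T * b         ≤⟨ Tb≤S ⟩
      S             ≤⟨ m≤m+n S rᵢ ⟩
      S + rᵢ        ≡⟨ S≡ ⟩
      rⱼ + T * D    <⟨ +-monoˡ-< (T * D) rⱼ<T ⟩
      T + T * D     ≡⟨ *-suc T D ⟨
      T * suc D     ∎))
    b≡D⇒ : T * b ≤ S → b ≡ D → rᵢ < rⱼ
    b≡D⇒ Tb≤S refl = ≤∧≢⇒< (+-cancelˡ-≤ (T * b) rᵢ rⱼ (begin
      T * b + rᵢ    ≤⟨ +-monoˡ-≤ rᵢ Tb≤S ⟩
      S + rᵢ        ≡⟨ S≡ ⟩
      rⱼ + T * b    ≡⟨ +-comm rⱼ (T * b) ⟩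
      T * b + rⱼ    ∎)) rᵢ≢rⱼ
    from : b ≤ D × (b ≡ D → rᵢ < rⱼ) → T * b ≤ S
    from (b≤D , b≡D⇒) with b ≟ D
    ... | yes refl = +-cancelʳ-≤ rᵢ (T * b) S (begin
      T * b + rᵢ    ≤⟨ +-monoʳ-≤ (T * b) (<⇒≤ (b≡D⇒ refl)) ⟩
      T * b + rⱼ    ≡⟨ +-comm (T * b) rⱼ ⟩
      rⱼ + T * b    ≡⟨ S≡ ⟨
      S + rᵢ        ∎)
    ... | no b≢D = <⇒≤ (+-cancelʳ-< T (T * b) S (begin-strict
      T * b + T     ≡⟨ +-comm (T * b) T ⟩
      T + T * b     ≡⟨ *-suc T b ⟨
      T * suc b     ≤⟨ *-monoʳ-≤ T (≤∧≢⇒< b≤D b≢D) ⟩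
      T * D         ≤⟨ m≤n+m (T * D) rⱼ ⟩
      rⱼ + T * D    ≡⟨ S≡ ⟨
      S + rᵢ        <⟨ +-monoʳ-< S rᵢ<T ⟩
      S + T         ∎))

  ≤multiple⇔ : rⱼ ≢ rᵢ → ∀ c → S ≤ T * c ⇔ (D ≤ c × (c ≡ D → rⱼ < rᵢ))
  ≤multiple⇔ rⱼ≢rᵢ c = mk⇔ (λ S≤Tc → D≤c S≤Tc , c≡D⇒ S≤Tc) from
    where
    D≤c : S ≤ T * c → D ≤ c
    D≤c S≤Tc with D ≤? c
    ... | yes D≤c = D≤c
    ... | no  D≰c = ⊥-elim (<-irrefl refl (begin-strict
      S + rᵢ        ≤⟨ +-monoˡ-≤ rᵢ S≤Tc ⟩
      T * c + rᵢ    <⟨ +-monoʳ-< (T * c) rᵢ<T ⟩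
      T * c + T     ≡⟨ +-comm (T * c) T ⟩
      T + T * c     ≡⟨ *-suc T c ⟨
      T * suc c     ≤⟨ *-monoʳ-≤ T (≰⇒> D≰c) ⟩
      T * D         ≤⟨ m≤n+m (T * D) rⱼ ⟩
      rⱼ + T * D    ≡⟨ S≡ ⟨
      S + rᵢ        ∎))
    c≡D⇒ : S ≤ T * c → c ≡ D → rⱼ < rᵢ
    c≡D⇒ S≤Tc refl = ≤∧≢⇒< (+-cancelˡ-≤ (T * c) rⱼ rᵢ (begin
      T * c + rⱼ    ≡⟨ +-comm (T * c) rⱼ ⟩
      rⱼ + T * c    ≡⟨ S≡ ⟨
      S + rᵢ        ≤⟨ +-monoˡ-≤ rᵢ S≤Tc ⟩
      T * c + rᵢ    ∎)) rⱼ≢rᵢ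
    from : D ≤ c × (c ≡ D → rⱼ < rᵢ) → S ≤ T * c
    from (D≤c , c≡D⇒) with c ≟ D
    ... | yes refl = <⇒≤ (+-cancelʳ-< rᵢ S (T * c) (begin-strict
      S + rᵢ        ≡⟨ S≡ ⟩
      rⱼ + T * c    <⟨ +-monoˡ-< (T * c) (c≡D⇒ refl) ⟩
      rᵢ + T * c    ≡⟨ +-comm rᵢ (T * c) ⟩
      T * c + rᵢ    ∎))
    ... | no c≢D = begin
      S             ≤⟨ m≤m+n S rᵢ ⟩
      S + rᵢ        ≡⟨ S≡ ⟩
      rⱼ + T * D    ≤⟨ +-monoˡ-≤ (T * D) (<⇒≤ rⱼ<T) ⟩
      T + T * D     ≡⟨ *-suc T D ⟨
      T * suc D     ≤⟨ *-monoʳ-≤ T (≤∧≢⇒< D≤c (c≢D ∘ sym)) ⟩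
      T * c         ∎

multiple-window⇔ : ∀ {T S s D} k → S ≡ s + T * D → 0 < s → s < T → (S ≤ T * suc k × T * suc k ≤ S + T) ⇔ D ≡ k
multiple-window⇔ {T} {S} {s} {D} k S≡ 0<s s<T = mk⇔ to from
  where
  open ≤-Reasoning
  to : S ≤ T * suc k × T * suc k ≤ S + T → D ≡ k
  to (S≤ , ≤S+T) = ≤-antisym D≤k k≤D
    where
    D≤k : D ≤ k
    D≤k with D ≤? k
    ... | yes D≤k = D≤k
    ... | no  D≰k = ⊥-elim (<-irrefl refl (begin-strict
      T * suc k     ≤⟨ *-monoʳ-≤ T (≰⇒> D≰k) ⟩
      T * D         <⟨ m<n+m (T * D) 0<s ⟩
      s + T * D     ≡⟨ S≡ ⟨
      S             ≤⟨ S≤ ⟩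
      T * suc k     ∎))
    k≤D : k ≤ D
    k≤D with k ≤? D
    ... | yes k≤D = k≤D
    ... | no  k≰D = ⊥-elim (<-irrefl refl (begin-strict
      T * suc k             ≤⟨ ≤S+T ⟩
      S + T                 ≡⟨ cong (_+ T) S≡ ⟩
      s + T * D + T         <⟨ +-monoˡ-< T (+-monoˡ-< (T * D) s<T) ⟩
      T + T * D + T         ≡⟨ cong (_+ T) (*-suc T D) ⟨
      T * suc D + T         ≡⟨ +-comm (T * suc D) T ⟩
      T + T * suc D         ≡⟨ *-suc T (suc D) ⟨
      T * suc (suc D)       ≤⟨ *-monoʳ-≤ T (s≤s (≰⇒> k≰D)) ⟩
      T * suc k             ∎))
  from : D ≡ k → S ≤ T * suc k × T * suc k ≤ S + T
  from refl = (begin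
      S             ≡⟨ S≡ ⟩
      s + T * D     ≤⟨ +-monoˡ-≤ (T * D) (<⇒≤ s<T) ⟩
      T + T * D     ≡⟨ *-suc T D ⟨
      T * suc D     ∎) ,
    (begin
      T * suc D     ≡⟨ *-suc T D ⟩
      T + T * D     ≤⟨ m≤n+m (T + T * D) s ⟩
      s + (T + T * D) ≡⟨ solve 3 (λ s T TD → s :+ (T :+ TD) := s :+ TD :+ T) refl s T (T * D) ⟩
      s + T * D + T ≡⟨ cong (_+ T) S≡ ⟨
      S + T         ∎)

module _ {t S rᵢ rⱼ D : ℕ} (rᵢ<T : rᵢ < suc t) (rⱼ<T : rⱼ < suc t) (S≡ : S + rᵢ ≡ rⱼ + suc t * D) where

  open import Data.Integer.Base using (+_; -[1+_])

  ℤ-multiple≤⇔ : rᵢ ≢ rⱼ → ∀ b → (+ suc t) ℤ.* b ℤ.≤ + S ⇔ (b ℤ.≤ + D × (b ≡ + D → rᵢ < rⱼ))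
  ℤ-multiple≤⇔ rᵢ≢rⱼ -[1+ b ] = mk⇔ (λ _ → ℤ.-≤+ , λ ()) (λ _ → ℤ.-≤+)
  ℤ-multiple≤⇔ rᵢ≢rⱼ (+ b)    = mk⇔
    (λ Tb≤S → let b≤D , b≡D⇒ = Equivalence.to ℕ⇔ (ℤP.drop‿+≤+ (subst (ℤ._≤ + S) (sym (ℤP.pos-* (suc t) b)) Tb≤S))
              in ℤ.+≤+ b≤D , b≡D⇒ ∘ ℤP.+-injective)
    (λ (b≤D , b≡D⇒) → subst (ℤ._≤ + S) (ℤP.pos-* (suc t) b)
              (ℤ.+≤+ (Equivalence.from ℕ⇔ (ℤP.drop‿+≤+ b≤D , b≡D⇒ ∘ cong (+_)))))
    where
    ℕ⇔ : suc t * b ≤ S ⇔ (b ≤ D × (b ≡ D → rᵢ < rⱼ))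
    ℕ⇔ = multiple≤⇔ rᵢ<T rⱼ<T S≡ rᵢ≢rⱼ b

  ℤ-≤multiple⇔ : rⱼ ≢ rᵢ → ∀ c → + S ℤ.≤ (+ suc t) ℤ.* c ⇔ (+ D ℤ.≤ c × (c ≡ + D → rⱼ < rᵢ))
  ℤ-≤multiple⇔ rⱼ≢rᵢ -[1+ c ] = mk⇔ (λ ()) (λ { (() , _) })
  ℤ-≤multiple⇔ rⱼ≢rᵢ (+ c)    = mk⇔
    (λ S≤Tc → let D≤c , c≡D⇒ = Equivalence.to ℕ⇔ (ℤP.drop‿+≤+ (subst (+ S ℤ.≤_) (sym (ℤP.pos-* (suc t) c)) S≤Tc))
              in ℤ.+≤+ D≤c , c≡D⇒ ∘ ℤP.+-injective)
    (λ (D≤c , c≡D⇒) → subst (+ S ℤ.≤_) (ℤP.pos-* (suc t) c)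
              (ℤ.+≤+ (Equivalence.from ℕ⇔ (ℤP.drop‿+≤+ D≤c , c≡D⇒ ∘ cong (+_)))))
    where
    ℕ⇔ : S ≤ suc t * c ⇔ (D ≤ c × (c ≡ D → rⱼ < rᵢ))
    ℕ⇔ = ≤multiple⇔ rᵢ<T rⱼ<T S≡ rⱼ≢rᵢ c

does-sound : {Q : Set} (d : Dec Q) → T (does d) → Q
does-sound (yes q) _ = q

does-complete : {Q : Set} (d : Dec Q) → Q → T (does d)
does-complete (yes _) _ = _
does-complete (no ¬q) q = ¬q q

allB⇔ : (f : A → Bool) (xs : List A) → T (allB f xs) ⇔ (∀ {x} → x ∈ xs → T (f x))
allB⇔ f xs = mk⇔ (to xs) (from xs)
  where
  to : ∀ xs → T (allB f xs) → ∀ {x} → x ∈ xs → T (f x)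
  to (y ∷ ys) h (here refl) = proj₁ (Equivalence.to T-∧ h)
  to (y ∷ ys) h (there x∈)  = to ys (proj₂ (Equivalence.to T-∧ h)) x∈
  from : ∀ xs → (∀ {x} → x ∈ xs → T (f x)) → T (allB f xs)
  from []       _ = _
  from (y ∷ ys) h = Equivalence.from T-∧ (h (here refl) , from ys (h ∘ there))

∈-pairs⇔ : ∀ m {i j} → (i , j) ∈ pairs m ⇔ (i < j × j ≤ m)
∈-pairs⇔ m {i} {j} = mk⇔ to from
  where
  column : ℕ → List (ℕ × ℕ)
  column j = map (λ i → i , j) (upTo j)
  to : (i , j) ∈ pairs m → i < j × j ≤ m
  to ij∈ with find (∈-concatMap⁻ column {xs = upTo (suc m)} ij∈)
  ... | j′ , j′∈ , ij∈col with ∈-map⁻ (λ i → i , j′) ij∈col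
  ... | i′ , i′∈ , refl = ∈-upTo⁻ i′∈ , ≤-pred (∈-upTo⁻ j′∈)
  from : i < j × j ≤ m → (i , j) ∈ pairs m
  from (i<j , j≤m) = ∈-concatMap⁺ column {xs = upTo (suc m)}
    (Any.map (λ { refl → ∈-map⁺ (λ i → i , j) (∈-upTo⁺ i<j) }) (∈-upTo⁺ (s≤s j≤m)))

allB-pairs⇔ : ∀ m (f : ℕ × ℕ → Bool) → T (allB f (pairs m)) ⇔ (∀ i j → i < j → j ≤ m → T (f (i , j)))
allB-pairs⇔ m f = mk⇔
  (λ h i j i<j j≤m → Equivalence.to (allB⇔ f (pairs m)) h (Equivalence.from (∈-pairs⇔ m) (i<j , j≤m)))
  (λ h → Equivalence.from (allB⇔ f (pairs m)) λ {(i , j)} ij∈ → let i<j , j≤m = Equivalence.to (∈-pairs⇔ m) ij∈ in h i j i<j j≤m)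

module _ (n k t : ℕ) (b c : ℕ → ℕ → ℤ) (z : Vec ℕ (n ∸ 1)) where

  open import Data.Integer.Base using (+_)

  InScaledP : Set
  InScaledP = (S z 0 (n ∸ 1) ≤ t * k) × (t * k ≤ S z 0 (n ∸ 1) + t) ×
              (∀ i j → i < j → j ≤ n ∸ 1 → ((+ t) ℤ.* b i j ℤ.≤ + S z i j) × (+ S z i j ℤ.≤ (+ t) ℤ.* c i j))

  T-inScaledP⇔ : T (inScaledP n k t b c z) ⇔ InScaledP
  T-inScaledP⇔ = mk⇔ to from
    where
    -- The pair test inside inScaledP, restated under a name; the two agree by η for pairs.
    pairTest : ℕ × ℕ → Bool
    pairTest (i , j) = does ((+ t) ℤ.* b i j ℤ.≤? + S z i j) ∧ does (+ S z i j ℤ.≤? (+ t) ℤ.* c i j)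
    split : ∀ a {a′} → T (a ∧ a′) → T a × T a′
    split true h = _ , h
    to : T (inScaledP n k t b c z) → InScaledP
    to h with split (S z 0 (n ∸ 1) ≤ᵇ t * k) h
    ... | h₁ , h₂₃ with split (t * k ≤ᵇ S z 0 (n ∸ 1) + t) h₂₃
    ... | h₂ , h₃ = ≤ᵇ⇒≤ _ _ h₁ , ≤ᵇ⇒≤ _ _ h₂ , λ i j i<j j≤m →
      let hᵢⱼ = split (does ((+ t) ℤ.* b i j ℤ.≤? + S z i j))
                      (Equivalence.to (allB-pairs⇔ (n ∸ 1) pairTest) h₃ i j i<j j≤m)
      in does-sound (_ ℤ.≤? _) (proj₁ hᵢⱼ) , does-sound (_ ℤ.≤? _) (proj₂ hᵢⱼ)
    from : InScaledP → T (inScaledP n k t b c z)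
    from (S≤ , ≤S+t , bounds) = Equivalence.from T-∧ (≤⇒≤ᵇ S≤ , Equivalence.from T-∧ (≤⇒≤ᵇ ≤S+t ,
      Equivalence.from (allB-pairs⇔ (n ∸ 1) pairTest) λ i j i<j j≤m →
        Equivalence.from T-∧ (does-complete (_ ℤ.≤? _) (proj₁ (bounds i j i<j j≤m)) , does-complete (_ ℤ.≤? _) (proj₂ (bounds i j i<j j≤m)))))

module ScaledMembership {n′ t : ℕ} (r : Vec ℕ (suc n′)) (r<T : All (_< suc t) (toList r)) (g : T (generic r)) where

  open import Data.Integer.Base using (+_)

  m : ℕ
  m = suc n′

  z : Vec ℕ m
  z = diffsMod (suc t) 0 r

  w : Vec ℕ m
  w = rank r

  wseq<T : ∀ p → wseq r p < suc t
  wseq<T zero    = s≤s z≤n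
  wseq<T (suc p) = at-All (s≤s z≤n) r<T p

  wseq-≢ : ∀ {i j} → i < j → j ≤ m → wseq r i ≢ wseq r j
  wseq-≢ i<j j≤m eq = <⇒≢ i<j (generic-wseq-injective r g (≤-trans (<⇒≤ i<j) j≤m) j≤m eq)

  S-telescopes : ∀ {i j} → i ≤ j → j ≤ m → S z i j + wseq r i ≡ wseq r j + suc t * des w i j
  S-telescopes {i} {j} i≤j j≤m =
    trans (partSum-diffsMod r (s≤s z≤n) r<T (j ∸ i) i i+[j∸i]≤m)
          (cong₂ (λ a d → wseq r a + suc t * d) (m+[n∸m]≡n i≤j) (sym (descFrom-rank r g i (j ∸ i) i+[j∸i]≤m)))
    where
    i+[j∸i]≤m : i + (j ∸ i) ≤ m
    i+[j∸i]≤m = subst (_≤ m) (sym (m+[n∸m]≡n i≤j)) j≤m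

  lower⇔ : ∀ {i j} → i < j → j ≤ m → ∀ b →
           (+ suc t) ℤ.* b ℤ.≤ + S z i j ⇔ (b ℤ.≤ + des w i j × (b ≡ + des w i j → wseq w i < wseq w j))
  lower⇔ {i} {j} i<j j≤m b = ⇔.trans
    (ℤ-multiple≤⇔ (wseq<T i) (wseq<T j) (S-telescopes (<⇒≤ i<j) j≤m) (wseq-≢ i<j j≤m) b)
    (mk⇔ (map₂ (Equivalence.from ord ∘_)) (map₂ (Equivalence.to ord ∘_)))
    where
    ord : wseq w i < wseq w j ⇔ wseq r i < wseq r j
    ord = wseq-rank-<⇔ r g (≤-trans (<⇒≤ i<j) j≤m) j≤m

  upper⇔ : ∀ {i j} → i < j → j ≤ m → ∀ c →
           + S z i j ℤ.≤ (+ suc t) ℤ.* c ⇔ (+ des w i j ℤ.≤ c × (c ≡ + des w i j → wseq w j < wseq w i))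
  upper⇔ {i} {j} i<j j≤m c = ⇔.trans
    (ℤ-≤multiple⇔ (wseq<T i) (wseq<T j) (S-telescopes (<⇒≤ i<j) j≤m) (wseq-≢ i<j j≤m ∘ sym) c)
    (mk⇔ (map₂ (Equivalence.from ord ∘_)) (map₂ (Equivalence.to ord ∘_)))
    where
    ord : wseq w j < wseq w i ⇔ wseq r j < wseq r i
    ord = wseq-rank-<⇔ r g j≤m (≤-trans (<⇒≤ i<j) j≤m)

  -- The telescoped sum yields des w 0 m, which is des w 1 m by computation since w₀ = 0 starts no descent.
  total⇔ : ∀ k′ → (S z 0 m ≤ suc t * suc k′ × suc t * suc k′ ≤ S z 0 m + suc t) ⇔ des w 1 m ≡ k′
  total⇔ k′ = multiple-window⇔ k′ (trans (sym (+-identityʳ _)) (S-telescopes z≤n ≤-refl))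
                                   (generic-positive r g ≤-refl) (wseq<T m)

  inScaledP⇔InW : ∀ k′ b c → T (inScaledP (suc m) (suc k′) (suc t) b c z) ⇔ InW (suc m) (suc k′) b c w
  inScaledP⇔InW k′ b c = ⇔.trans (T-inScaledP⇔ (suc m) (suc k′) (suc t) b c z) (mk⇔ to from)
    where
    to : InScaledP (suc m) (suc k′) (suc t) b c z → InW (suc m) (suc k′) b c w
    to (S≤ , ≤S+t , bounds) = record
      { perm  = rank-isPerm r g
      ; cond1 = Equivalence.to (total⇔ k′) (S≤ , ≤S+t)
      ; cond2 = λ i j i<j j≤m → Equivalence.to (lower⇔ i<j j≤m (b i j)) (proj₁ (bounds i j i<j j≤m))
      ; cond3 = λ i j i<j j≤m → Equivalence.to (upper⇔ i<j j≤m (c i j)) (proj₂ (bounds i j i<j j≤m))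
      }
    from : InW (suc m) (suc k′) b c w → InScaledP (suc m) (suc k′) (suc t) b c z
    from iw = proj₁ window , proj₂ window , λ i j i<j j≤m →
        Equivalence.from (lower⇔ i<j j≤m (b i j)) (InW.cond2 iw i j i<j j≤m)
      , Equivalence.from (upper⇔ i<j j≤m (c i j)) (InW.cond3 iw i j i<j j≤m)
      where
      window : S z 0 m ≤ suc t * suc k′ × suc t * suc k′ ≤ S z 0 m + suc t
      window = Equivalence.from (total⇔ k′) (InW.cond1 iw)

IsPerm⇔ : {m : ℕ} (w : Vec ℕ m) → IsPerm w ⇔ (Unique (toList w) × All (_∈ map suc (upTo m)) (toList w))
IsPerm⇔ {m} w = mk⇔
  (λ w↭ → Unique-resp-↭ (↭-sym w↭) (UniqueP.map⁺ suc-injective (UniqueP.upTo⁺ m)) , All.tabulate (∈-resp-↭ w↭))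
  (λ (uw , w⊆) → ↭-sym (Unique-⊆-length≥⇒↭ uw (All.lookup w⊆)
     (≤-reflexive (trans (length-map suc (upTo m)) (trans (length-upTo m) (sym (length-toList w)))))))

IsPerm? : {m : ℕ} (w : Vec ℕ m) → Dec (IsPerm w)
IsPerm? {m} w = map′ (Equivalence.from (IsPerm⇔ w)) (Equivalence.to (IsPerm⇔ w))
  (unique? (toList w) ×-dec All.all? (_∈? map suc (upTo m)) (toList w))

IsPerm⇒≤ : {m : ℕ} (w : Vec ℕ m) → IsPerm w → All (_≤ m) (toList w)
IsPerm⇒≤ {m} w w↭ = All.tabulate λ x∈ → let i , i∈ , x≡ = ∈-map⁻ suc (∈-resp-↭ w↭ x∈) in subst (_≤ m) (sym x≡) (∈-upTo⁻ i∈)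

∀-pairs? : ∀ m {Q : ℕ → ℕ → Set} → (∀ i j → Dec (Q i j)) → Dec (∀ i j → i < j → j ≤ m → Q i j)
∀-pairs? m {Q} Q? = map′
  (λ h i j i<j j≤m → does-sound (Q? i j) (Equivalence.to (allB-pairs⇔ m test) h i j i<j j≤m))
  (λ h → Equivalence.from (allB-pairs⇔ m test) λ i j i<j j≤m → does-complete (Q? i j) (h i j i<j j≤m))
  (T? (allB test (pairs m)))
  where
  test : ℕ × ℕ → Bool
  test (i , j) = does (Q? i j)

InW? : ∀ n k b c (w : Vec ℕ (n ∸ 1)) → Dec (InW n k b c w)
InW? n k b c w = map′
  (λ (p , d₁ , d₂ , d₃) → record { perm = p ; cond1 = d₁ ; cond2 = d₂ ; cond3 = d₃ })
  (λ iw → InW.perm iw , InW.cond1 iw , InW.cond2 iw , InW.cond3 iw)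
  (IsPerm? w ×-dec des w 1 (n ∸ 1) ≟ k ∸ 1 ×-dec
   ∀-pairs? (n ∸ 1) (λ i j → b i j ℤ.≤? + des w i j ×-dec (b i j ℤ.≟ + des w i j →-dec wseq w i <? wseq w j)) ×-dec
   ∀-pairs? (n ∸ 1) (λ i j → + des w i j ℤ.≤? c i j ×-dec (c i j ℤ.≟ + des w i j →-dec wseq w j <? wseq w i)))
  where open import Data.Integer.Base using (+_)

W-P : ∀ n k b c → List (Vec ℕ (n ∸ 1))
W-P n k b c = filter (InW? n k b c) (grid (n ∸ 1) (n ∸ 1))

W-P-unique : ∀ n k b c → Unique (W-P n k b c)
W-P-unique n k b c = UniqueP.filter⁺ (InW? n k b c) (grid-unique (n ∸ 1) (n ∸ 1))

∈-W-P⇔ : ∀ n k b c w → w ∈ W-P n k b c ⇔ InW n k b c w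
∈-W-P⇔ n k b c w = mk⇔
  (proj₂ ∘ ∈-filter⁻ (InW? n k b c) {xs = grid (n ∸ 1) (n ∸ 1)})
  (λ iw → ∈-filter⁺ (InW? n k b c) (∈-grid⁺ (n ∸ 1) w (IsPerm⇒≤ w (InW.perm iw))) iw)

increasingFrom : ℕ → List ℕ → Bool
increasingFrom ℓ []       = true
increasingFrom ℓ (x ∷ xs) = (ℓ <ᵇ x) ∧ increasingFrom x xs

increasing : {m : ℕ} → Vec ℕ m → Bool
increasing a = increasingFrom 0 (toList a)

increasingFrom⇔ : ∀ ℓ xs → T (increasingFrom ℓ xs) ⇔ (∀ {p} → p < length xs → at (ℓ ∷ xs) p < at xs p)
increasingFrom⇔ ℓ xs = mk⇔ (to ℓ xs) (from ℓ xs)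
  where
  to : ∀ ℓ xs → T (increasingFrom ℓ xs) → ∀ {p} → p < length xs → at (ℓ ∷ xs) p < at xs p
  to ℓ (x ∷ xs) h {zero}  _        = <ᵇ⇒< ℓ x (proj₁ (Equivalence.to T-∧ h))
  to ℓ (x ∷ xs) h {suc p} (s≤s p<) = to x xs (proj₂ (Equivalence.to T-∧ h)) p<
  from : ∀ ℓ xs → (∀ {p} → p < length xs → at (ℓ ∷ xs) p < at xs p) → T (increasingFrom ℓ xs)
  from ℓ []       _ = _
  from ℓ (x ∷ xs) h = Equivalence.from T-∧ (<⇒<ᵇ (h (s≤s z≤n)) , from x xs (λ p< → h (s≤s p<)))

increasing⇔ : {m : ℕ} (a : Vec ℕ m) → T (increasing a) ⇔ (∀ {p} → p < m → wseq a p < wseq a (suc p))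
increasing⇔ a = ⇔.trans (increasingFrom⇔ 0 (toList a))
  (mk⇔ (λ h {p} p< → subst (_< wseq a (suc p)) (sym (wseq≡at a p)) (h (subst (p <_) (sym (length-toList a)) p<)))
       (λ h {p} p< → subst (_< at (toList a) p) (wseq≡at a p) (h (subst (p <_) (length-toList a) p<))))

increasing⇒wseq-< : {m : ℕ} (a : Vec ℕ m) → T (increasing a) → ∀ {p q} → p < q → q ≤ m → wseq a p < wseq a q
increasing⇒wseq-< a inc {p} {suc q} (s≤s p≤q) q<m with m≤n⇒m<n∨m≡n p≤q
... | inj₁ p<q  = <-trans (increasing⇒wseq-< a inc p<q (<⇒≤ q<m)) (Equivalence.to (increasing⇔ a) inc q<m)
... | inj₂ refl = Equivalence.to (increasing⇔ a) inc q<m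

count-increasingFrom : ∀ t m ℓ → count (λ (a : Vec ℕ m) → increasingFrom ℓ (toList a)) (grid t m) ≡ (t ∸ ℓ) C m
count-increasingFrom t zero    ℓ = refl
count-increasingFrom t (suc m) ℓ = begin
  count (λ a → increasingFrom ℓ (toList a)) (grid t (suc m))
    ≡⟨ count-grid-suc {m} t (λ a → increasingFrom ℓ (toList a)) ⟩
  sum (map (λ a → count (λ v → (ℓ <ᵇ a) ∧ increasingFrom a (toList v)) (grid t m)) (upTo (suc t)))
    ≡⟨ sum-map-cong (upTo (suc t)) (λ {a} _ → trans (count-const-∧ (ℓ <ᵇ a) (λ v → increasingFrom a (toList v)) (grid t m))
                                                     (cong (indicator (ℓ <ᵇ a) *_) (count-increasingFrom t m a))) ⟩
  sum (map (λ a → indicator (ℓ <ᵇ a) * ((t ∸ a) C m)) (upTo (suc t)))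
    ≡⟨ hockey-stick m ℓ t ⟩
  (t ∸ ℓ) C suc m ∎
  where open ≡-Reasoning

-- The fibres of rank

compose : {m ℓ : ℕ} → Vec ℕ m → Vec ℕ ℓ → Vec ℕ ℓ
compose a w = Vec.map (wseq a) w

wseq-compose : {m ℓ : ℕ} (a : Vec ℕ m) (w : Vec ℕ ℓ) → ∀ p → wseq (compose a w) p ≡ wseq a (wseq w p)
wseq-compose a w zero    = refl
wseq-compose a w (suc p) = trans (cong (λ l → at l p) (toList-map (wseq a) w)) (at-map₀ (toList w) p)
  where
  at-map₀ : ∀ xs p → at (map (wseq a) xs) p ≡ wseq a (at xs p)
  at-map₀ []       p       = refl
  at-map₀ (x ∷ xs) zero    = refl
  at-map₀ (x ∷ xs) (suc p) = at-map₀ xs p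

compose-∈-grid : ∀ {t m ℓ} {a : Vec ℕ m} (w : Vec ℕ ℓ) → a ∈ grid t m → compose a w ∈ grid t ℓ
compose-∈-grid {t} {a = a} w a∈ = ∈-grid⁺ t (compose a w) (subst (All (_≤ t)) (sym (toList-map (wseq a) w)) entries≤)
  where
  wseq≤ : ∀ x → wseq a x ≤ t
  wseq≤ zero    = z≤n
  wseq≤ (suc x) = at-All z≤n (∈-grid⁻ t a a∈) x
  entries≤ : All (_≤ t) (map (wseq a) (toList w))
  entries≤ = All.tabulate λ y∈ → let x , _ , y≡ = ∈-map⁻ (wseq a) y∈ in subst (_≤ t) (sym y≡) (wseq≤ x)

indexOf : ℕ → List ℕ → ℕ
indexOf x []       = 0
indexOf x (y ∷ ys) = if x ≡ᵇ y then 0 else suc (indexOf x ys)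

at-indexOf : ∀ {x} xs → x ∈ xs → at xs (indexOf x xs) ≡ x × indexOf x xs < length xs
at-indexOf {x} (y ∷ ys) x∈ with x ≡ᵇ y in eq | x∈
... | true  | _          = sym (≡ᵇ⇒≡ x y (subst T (sym eq) _)) , s≤s z≤n
... | false | here refl  = ⊥-elim (subst T eq (≡⇒≡ᵇ x x refl))
... | false | there x∈ys = map₂ s≤s (at-indexOf ys x∈ys)

indexOf-at : ∀ xs {i} → Unique xs → i < length xs → indexOf (at xs i) xs ≡ i
indexOf-at xs ux i< = let x≡ , index< = at-indexOf xs (at-∈ xs i<) in Unique⇒at-injective xs ux index< i< x≡

inverse : {m : ℕ} → Vec ℕ m → Vec ℕ m
inverse {m} w = Vec.map (λ i → suc (indexOf (suc i) (toList w))) (iterate suc 0 m)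

at-iterate-suc : ∀ s m {i} → i < m → at (toList (iterate suc s m)) i ≡ s + i
at-iterate-suc s (suc m) {zero}  _        = sym (+-identityʳ s)
at-iterate-suc s (suc m) {suc i} (s≤s i<) = trans (at-iterate-suc (suc s) m i<) (sym (+-suc s i))

count-<ᵇ-upTo : ∀ n {i} → i ≤ n → count (_<ᵇ i) (upTo n) ≡ i
count-<ᵇ-upTo n       {zero}  _        = count-false (upTo n)
count-<ᵇ-upTo (suc n) {suc i} (s≤s i≤n) = begin
  count (_<ᵇ suc i) (upTo (suc n))         ≡⟨ cong (λ l → 1 + count (_<ᵇ suc i) l) (map-upTo suc n) ⟨
  1 + count (_<ᵇ suc i) (map suc (upTo n)) ≡⟨ cong suc (count-map (_<ᵇ suc i) suc (upTo n)) ⟩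
  1 + count (_<ᵇ i) (upTo n)               ≡⟨ cong suc (count-<ᵇ-upTo n i≤n) ⟩
  suc i                                     ∎
  where open ≡-Reasoning

IsPerm⇒generic : {m : ℕ} (w : Vec ℕ m) → IsPerm w → T (generic w)
IsPerm⇒generic w w↭ = Unique⇒generic w (All.tabulate 0∉ ∷ proj₁ (Equivalence.to (IsPerm⇔ w) w↭))
  where
  0∉ : ∀ {x} → x ∈ toList w → 0 ≢ x
  0∉ x∈ refl with ∈-map⁻ suc (∈-resp-↭ w↭ x∈)
  ... | _ , _ , ()

increasing-<ᵇ : {m : ℕ} (a : Vec ℕ m) → T (increasing a) → ∀ {x y} → x ≤ m → y ≤ m → (wseq a x <ᵇ wseq a y) ≡ (x <ᵇ y)
increasing-<ᵇ a inc {x} {y} x≤m y≤m with <-cmp x y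
... | tri< x<y _ _ = trans (T⇒≡true (<⇒<ᵇ (increasing⇒wseq-< a inc x<y y≤m))) (sym (T⇒≡true (<⇒<ᵇ x<y)))
... | tri≈ _ refl _ = trans (¬T⇒≡false (<-irrefl refl ∘ <ᵇ⇒< (wseq a x) (wseq a x))) (sym (¬T⇒≡false (<-irrefl refl ∘ <ᵇ⇒< x x)))
... | tri> _ _ y<x = trans (¬T⇒≡false (<⇒≯ (increasing⇒wseq-< a inc y<x x≤m) ∘ <ᵇ⇒< _ _)) (sym (¬T⇒≡false (<⇒≯ y<x ∘ <ᵇ⇒< _ _)))

_≟ᵥ_ : {m : ℕ} (v w : Vec ℕ m) → Dec (v ≡ w)
_≟ᵥ_ = ≡-dec _≟_

module Fibre {m : ℕ} (w : Vec ℕ m) (w↭ : IsPerm w) where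

  W : List ℕ
  W = toList w

  w≤m : ∀ j → wseq w j ≤ m
  w≤m zero    = z≤n
  w≤m (suc j) = at-All z≤n (IsPerm⇒≤ w w↭) j

  entry : ∀ {j} → j < m → ∃ λ i → at W j ≡ suc i × i < m
  entry j<m with ∈-map⁻ suc (∈-resp-↭ w↭ (at-∈ W (subst (_ <_) (sym (length-toList w)) j<m)))
  ... | i , i∈ , eq = i , eq , ∈-upTo⁻ i∈

  indexOf-bounds : ∀ {i} → i < m → at W (indexOf (suc i) W) ≡ suc i × indexOf (suc i) W < m
  indexOf-bounds {i} i<m = map₂ (subst (indexOf (suc i) W <_) (length-toList w)) (at-indexOf W (∈-resp-↭ (↭-sym w↭) (∈-map⁺ suc (∈-upTo⁺ i<m))))

  at-inverse : ∀ {i} → i < m → at (toList (inverse w)) i ≡ suc (indexOf (suc i) W)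
  at-inverse {i} i<m = begin
    at (toList (inverse w)) i                   ≡⟨ cong (λ l → at l i) (toList-map f (iterate suc 0 m)) ⟩
    at (map f (toList (iterate suc 0 m))) i     ≡⟨ at-map f (toList (iterate suc 0 m)) (subst (i <_) (sym (length-toList (iterate suc 0 m))) i<m) ⟩
    f (at (toList (iterate suc 0 m)) i)         ≡⟨ cong f (at-iterate-suc 0 m i<m) ⟩
    f i                                         ∎
    where
    open ≡-Reasoning
    f : ℕ → ℕ
    f i = suc (indexOf (suc i) W)

  inverse≤m : ∀ {i} → i ≤ m → wseq (inverse w) i ≤ m
  inverse≤m {zero}  _   = z≤n
  inverse≤m {suc i} i<m = subst (_≤ m) (sym (at-inverse i<m)) (proj₂ (indexOf-bounds i<m))

  w∘inverse : ∀ {i} → i ≤ m → wseq w (wseq (inverse w) i) ≡ i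
  w∘inverse {zero}  _   = refl
  w∘inverse {suc i} i<m = trans (cong (wseq w) (at-inverse i<m)) (proj₁ (indexOf-bounds i<m))

  inverse∘w : ∀ {j} → j ≤ m → wseq (inverse w) (wseq w j) ≡ j
  inverse∘w {zero}  _   = refl
  inverse∘w {suc j} j<m with entry j<m
  ... | i , wⱼ≡ , i<m = begin
    wseq (inverse w) (at W j)           ≡⟨ cong (wseq (inverse w)) wⱼ≡ ⟩
    wseq (inverse w) (suc i)            ≡⟨ at-inverse i<m ⟩
    suc (indexOf (suc i) W)             ≡⟨ cong (λ x → suc (indexOf x W)) wⱼ≡ ⟨
    suc (indexOf (at W j) W)            ≡⟨ cong suc (indexOf-at W (proj₁ (Equivalence.to (IsPerm⇔ w) w↭)) (subst (j <_) (sym (length-toList w)) j<m)) ⟩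
    suc j                               ∎
    where open ≡-Reasoning

  compose-inverse-compose : (r : Vec ℕ m) → compose (compose r (inverse w)) w ≡ r
  compose-inverse-compose r = Vec-at-ext _ r λ {j} j<m → begin
    wseq (compose (compose r (inverse w)) w) (suc j)    ≡⟨ wseq-compose (compose r (inverse w)) w (suc j) ⟩
    wseq (compose r (inverse w)) (wseq w (suc j))      ≡⟨ wseq-compose r (inverse w) (wseq w (suc j)) ⟩
    wseq r (wseq (inverse w) (wseq w (suc j)))         ≡⟨ cong (wseq r) (inverse∘w j<m) ⟩
    wseq r (suc j)                                      ∎
    where open ≡-Reasoning

  compose-compose-inverse : (a : Vec ℕ m) → compose (compose a w) (inverse w) ≡ a
  compose-compose-inverse a = Vec-at-ext _ a λ {i} i<m → begin
    wseq (compose (compose a w) (inverse w)) (suc i)    ≡⟨ wseq-compose (compose a w) (inverse w) (suc i) ⟩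
    wseq (compose a w) (wseq (inverse w) (suc i))      ≡⟨ wseq-compose a w (wseq (inverse w) (suc i)) ⟩
    wseq a (wseq w (wseq (inverse w) (suc i)))         ≡⟨ cong (wseq a) (w∘inverse i<m) ⟩
    wseq a (suc i)                                      ∎
    where open ≡-Reasoning

  compose-injective : ∀ {a a′ : Vec ℕ m} → compose a w ≡ compose a′ w → a ≡ a′
  compose-injective {a} {a′} eq =
    trans (sym (compose-compose-inverse a)) (trans (cong (λ r → compose r (inverse w)) eq) (compose-compose-inverse a′))

  increasing⇒generic : (a : Vec ℕ m) → T (increasing a) → T (generic (compose a w))
  increasing⇒generic a inc = Unique⇒generic (compose a w) (at-injective⇒Unique (0 ∷ toList (compose a w)) injective)
    where
    a-injective : ∀ {x y} → x ≤ m → y ≤ m → wseq a x ≡ wseq a y → x ≡ y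
    a-injective {x} {y} x≤m y≤m eq with <-cmp x y
    ... | tri< x<y _ _ = ⊥-elim (<-irrefl eq (increasing⇒wseq-< a inc x<y y≤m))
    ... | tri≈ _ x≡y _ = x≡y
    ... | tri> _ _ y<x = ⊥-elim (<-irrefl (sym eq) (increasing⇒wseq-< a inc y<x x≤m))
    injective : ∀ {i j} → i < length (0 ∷ toList (compose a w)) → j < length (0 ∷ toList (compose a w)) →
                at (0 ∷ toList (compose a w)) i ≡ at (0 ∷ toList (compose a w)) j → i ≡ j
    injective {i} {j} i< j< eq =
      generic-wseq-injective w (IsPerm⇒generic w w↭) (bound i<) (bound j<)
        (a-injective (w≤m i) (w≤m j)
          (trans (sym (wseq-compose a w i)) (trans (wseq≡at (compose a w) i) (trans eq (trans (sym (wseq≡at (compose a w) j)) (wseq-compose a w j))))))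
      where
      bound : ∀ {p} → p < length (0 ∷ toList (compose a w)) → p ≤ m
      bound (s≤s p≤) = subst (_ ≤_) (length-toList (compose a w)) p≤

  increasing⇒rank : (a : Vec ℕ m) → T (increasing a) → rank (compose a w) ≡ w
  increasing⇒rank a inc = Vec-at-ext (rank (compose a w)) w λ {j} j<m → let i , wⱼ≡ , i<m = entry j<m in begin
    at (toList (rank r)) j                                   ≡⟨ at-rank r j<m ⟩
    rankIn R (at R j)                                        ≡⟨ cong (rankIn R) (wseq-compose a w (suc j)) ⟩
    suc (count (_<ᵇ wseq a (at W j)) R)                      ≡⟨ cong (λ l → suc (count (_<ᵇ wseq a (at W j)) l)) (toList-map (wseq a) w) ⟩
    suc (count (_<ᵇ wseq a (at W j)) (map (wseq a) W))       ≡⟨ cong suc (count-map _ (wseq a) W) ⟩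
    suc (count (λ x → wseq a x <ᵇ wseq a (at W j)) W)        ≡⟨ cong suc (count-cong W λ {x} x∈ →
                                                                  let y , y∈ , x≡ = ∈-map⁻ suc (∈-resp-↭ w↭ x∈) in
                                                                  increasing-<ᵇ a inc (subst (_≤ m) (sym x≡) (∈-upTo⁻ y∈)) (w≤m (suc j))) ⟩
    suc (count (_<ᵇ at W j) W)                               ≡⟨ cong suc (count-↭ (_<ᵇ at W j) w↭) ⟩
    suc (count (_<ᵇ at W j) (map suc (upTo m)))              ≡⟨ cong suc (count-map (_<ᵇ at W j) suc (upTo m)) ⟩
    suc (count (λ x → suc x <ᵇ at W j) (upTo m))             ≡⟨ cong (λ v → suc (count (λ x → suc x <ᵇ v) (upTo m))) wⱼ≡ ⟩
    suc (count (_<ᵇ i) (upTo m))                             ≡⟨ cong suc (count-<ᵇ-upTo m (<⇒≤ i<m)) ⟩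
    suc i                                                    ≡⟨ wⱼ≡ ⟨
    at W j                                                   ∎
    where
    open ≡-Reasoning
    r : Vec ℕ m
    r = compose a w
    R : List ℕ
    R = toList r

  rank⇒increasing : (r : Vec ℕ m) → T (generic r) → rank r ≡ w → T (increasing (compose r (inverse w)))
  rank⇒increasing r g rank≡w = Equivalence.from (increasing⇔ (compose r (inverse w))) λ {p} p<m →
    subst₂ _<_ (sym (wseq-compose r (inverse w) p)) (sym (wseq-compose r (inverse w) (suc p)))
      (Equivalence.to (wseq-rank-<⇔ r g (inverse≤m (<⇒≤ p<m)) (inverse≤m p<m))
        (subst (λ v → wseq v (wseq (inverse w) p) < wseq v (wseq (inverse w) (suc p))) (sym rank≡w)
          (subst₂ _<_ (sym (w∘inverse (<⇒≤ p<m))) (sym (w∘inverse p<m)) ≤-refl)))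

  count-fibre : ∀ t → count (λ r → generic r ∧ does (rank r ≟ᵥ w)) (grid t m) ≡ count increasing (grid t m)
  count-fibre t = ≤-antisym
    (subst₂ _≤_ (length-filter≡count inFibre V) lengthY (Unique-⊆⇒length≤ uX X⊆Y))
    (subst₂ _≤_ lengthY (length-filter≡count inFibre V) (Unique-⊆⇒length≤ uY Y⊆X))
    where
    V : List (Vec ℕ m)
    V = grid t m
    inFibre : Vec ℕ m → Bool
    inFibre r = generic r ∧ does (rank r ≟ᵥ w)
    X Y : List (Vec ℕ m)
    X = filter (λ r → T? (inFibre r)) V
    Y = map (λ a → compose a w) (filter (λ a → T? (increasing a)) V)
    lengthY : length Y ≡ count increasing V
    lengthY = trans (length-map _ (filter (λ a → T? (increasing a)) V)) (length-filter≡count increasing V)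
    uX : Unique X
    uX = UniqueP.filter⁺ (λ r → T? (inFibre r)) (grid-unique t m)
    uY : Unique Y
    uY = UniqueP.map⁺ compose-injective (UniqueP.filter⁺ (λ a → T? (increasing a)) (grid-unique t m))
    X⊆Y : X ⊆ Y
    X⊆Y {r} r∈ with ∈-filter⁻ (λ r → T? (inFibre r)) {xs = V} r∈
    ... | r∈V , h with Equivalence.to T-∧ h
    ... | g , rank≡ = subst (_∈ Y) (compose-inverse-compose r)
      (∈-map⁺ (λ a → compose a w) (∈-filter⁺ (λ a → T? (increasing a)) (compose-∈-grid (inverse w) r∈V)
        (rank⇒increasing r g (does-sound (rank r ≟ᵥ w) rank≡))))
    Y⊆X : Y ⊆ X
    Y⊆X r∈ with ∈-map⁻ (λ a → compose a w) r∈
    ... | a , a∈ , refl with ∈-filter⁻ (λ a → T? (increasing a)) {xs = V} a∈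
    ... | a∈V , inc = ∈-filter⁺ (λ r → T? (inFibre r)) (compose-∈-grid w a∈V)
      (Equivalence.from T-∧ (increasing⇒generic a inc , does-complete (rank (compose a w) ≟ᵥ w) (increasing⇒rank a inc)))

Unique-++⇒∉ : (xs : List A) → Unique (xs ++ ys) → y ∈ ys → y ∉ xs
Unique-++⇒∉ (x ∷ xs) (x∉ ∷ _)  y∈ys (here refl) = All.lookup x∉ (∈-++⁺ʳ xs y∈ys) refl
Unique-++⇒∉ (x ∷ xs) (_ ∷ uxs) y∈ys (there y∈xs) = Unique-++⇒∉ xs uxs y∈ys y∈xs

count-∉-upTo : ∀ N E → Unique E → E ⊆ upTo N → count (λ a → not (does (a ∈? E))) (upTo N) ≡ N ∸ length E
count-∉-upTo N E uE E⊆ with Unique-⊆⇒↭-++ uE E⊆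
... | zs , upTo↭ = begin
  count ∉E (upTo N)                  ≡⟨ count-↭ ∉E upTo↭ ⟩
  count ∉E (E ++ zs)                 ≡⟨ count-++ ∉E E zs ⟩
  count ∉E E + count ∉E zs           ≡⟨ cong₂ _+_ (trans (count-cong E in-E) (count-false E)) (trans (count-cong zs in-zs) (count-true zs)) ⟩
  length zs                          ≡⟨ m+n∸m≡n (length E) (length zs) ⟨
  length E + length zs ∸ length E    ≡⟨ cong (_∸ length E) (trans (↭-length upTo↭) (length-++ E)) ⟨
  length (upTo N) ∸ length E         ≡⟨ cong (_∸ length E) (length-upTo N) ⟩
  N ∸ length E                       ∎
  where
  open ≡-Reasoning
  ∉E : ℕ → Bool
  ∉E a = not (does (a ∈? E))
  uEzs : Unique (E ++ zs)
  uEzs = Unique-resp-↭ upTo↭ (UniqueP.upTo⁺ N)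
  in-E : ∀ {a} → a ∈ E → ∉E a ≡ false
  in-E a∈ = cong not (T⇒≡true (does-complete (_ ∈? E) a∈))
  in-zs : ∀ {a} → a ∈ zs → ∉E a ≡ true
  in-zs a∈ = cong not (¬T⇒≡false (Unique-++⇒∉ E uEzs a∈ ∘ does-sound (_ ∈? E)))

count-distinctOutside : ∀ t m E → Unique E → E ⊆ upTo (suc t) →
  count (λ (v : Vec ℕ m) → distinctOutside E (toList v)) (grid t m) ≡ (suc t ∸ length E) P m
count-distinctOutside t zero    E _  _  = refl
count-distinctOutside t (suc m) E uE E⊆ = begin
  count (λ v → distinctOutside E (toList v)) (grid t (suc m))
    ≡⟨ count-grid-suc {m} t (λ v → distinctOutside E (toList v)) ⟩
  sum (map (λ a → count (λ v → not (does (a ∈? E)) ∧ distinctOutside (a ∷ E) (toList v)) (grid t m)) (upTo (suc t)))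
    ≡⟨ sum-map-cong (upTo (suc t)) row ⟩
  sum (map (λ a → indicator (not (does (a ∈? E))) * F) (upTo (suc t)))
    ≡⟨ sum-indicator (λ a → not (does (a ∈? E))) F (upTo (suc t)) ⟩
  count (λ a → not (does (a ∈? E))) (upTo (suc t)) * F
    ≡⟨ cong (_* F) (count-∉-upTo (suc t) E uE E⊆) ⟩
  (suc t ∸ length E) * F
    ≡⟨ cong (λ x → (suc t ∸ length E) * (x P m)) (∸-+-assoc (suc t) (length E) 1) ⟨
  (suc t ∸ length E) * ((suc t ∸ length E ∸ 1) P m)
    ≡⟨ P-suc (suc t ∸ length E) m ⟨
  (suc t ∸ length E) P suc m ∎
  where
  open ≡-Reasoning
  F : ℕ
  F = (suc t ∸ (length E + 1)) P m
  row : ∀ {a} → a ∈ upTo (suc t) →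
        count (λ v → not (does (a ∈? E)) ∧ distinctOutside (a ∷ E) (toList v)) (grid t m) ≡ indicator (not (does (a ∈? E))) * F
  row {a} a∈ with a ∈? E
  ... | yes _  = count-false (grid t m)
  ... | no a∉E = trans (count-const-∧ true (λ v → distinctOutside (a ∷ E) (toList v)) (grid t m))
                   (trans (cong (1 *_) (count-distinctOutside t m (a ∷ E) (All.tabulate (λ y∈ a≡y → a∉E (subst (_∈ E) (sym a≡y) y∈)) ∷ uE)
                                          λ { (here refl) → a∈ ; (there y∈) → E⊆ y∈ }))
                          (cong (λ x → 1 * (x P m)) (cong (suc t ∸_) (+-comm 1 (length E)))))

module _ {B : Set} (_≟B_ : DecidableEquality B) where

  open import Data.List.Membership.DecPropositional _≟B_ using () renaming (_∈?_ to _∈B?_)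

  count-fibres : (g : A → Bool) (f : A → B) (xs : List A) (L : List B) → Unique L →
                 count (λ x → g x ∧ does (f x ∈B? L)) xs ≡ sum (map (λ y → count (λ x → g x ∧ does (f x ≟B y)) xs) L)
  count-fibres g f xs []      _          = trans (count-cong xs (λ {x} _ → ∧-zeroʳ (g x))) (count-false xs)
  count-fibres g f xs (y ∷ L) (y∉ ∷ uL) =
    trans (split xs) (cong (count (λ x → g x ∧ does (f x ≟B y)) xs +_) (count-fibres g f xs L uL))
    where
    split : ∀ xs → count (λ x → g x ∧ does (f x ∈B? (y ∷ L))) xs ≡
                   count (λ x → g x ∧ does (f x ≟B y)) xs + count (λ x → g x ∧ does (f x ∈B? L)) xs
    split []       = refl
    split (x ∷ xs) with g x | f x ≟B y | f x ∈B? L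
    ... | false | _        | _      = split xs
    ... | true  | no _     | no _   = split xs
    ... | true  | no _     | yes _  = trans (cong suc (split xs)) (sym (+-suc _ _))
    ... | true  | yes _    | no _   = cong suc (split xs)
    ... | true  | yes refl | yes fx∈L = ⊥-elim (All.lookup y∉ fx∈L refl)

count+count-not≡length : (q : A → Bool) (xs : List A) → count q xs + count (not ∘ q) xs ≡ length xs
count+count-not≡length q xs = trans (sym (count-split (λ _ → true) q xs)) (count-true xs)

module GridCount (n′ k′ t : ℕ) (b c : ℕ → ℕ → ℤ) where

  m : ℕ
  m = suc n′

  inP : Vec ℕ m → Bool
  inP = inScaledP (suc m) (suc k′) (suc t) b c

  Wₚ : List (Vec ℕ m)
  Wₚ = W-P (suc m) (suc k′) b c

  ψ : Vec ℕ m → Vec ℕ m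
  ψ = diffsMod (suc t) 0

  below : Vec ℕ m → Bool
  below z = all (_≤ᵇ t) (toList z)

  generic-part : count (λ r → inP (ψ r) ∧ generic r) (grid t m) ≡ length Wₚ * (t C m)
  generic-part = begin
    count (λ r → inP (ψ r) ∧ generic r) (grid t m)
      ≡⟨ count-cong (grid t m) (λ r∈ → inP∘ψ≡ _ (grid-< r∈)) ⟩
    count (λ r → generic r ∧ does (rank r ∈ᵥ? Wₚ)) (grid t m)
      ≡⟨ count-fibres _≟ᵥ_ generic rank (grid t m) Wₚ (W-P-unique (suc m) (suc k′) b c) ⟩
    sum (map (λ w → count (λ r → generic r ∧ does (rank r ≟ᵥ w)) (grid t m)) Wₚ)
      ≡⟨ sum-map-const _ (t C m) Wₚ (λ w∈ → trans (Fibre.count-fibre _ (InW.perm (Equivalence.to (∈-W-P⇔ (suc m) (suc k′) b c _) w∈)) t)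
                                                  (count-increasingFrom t m 0)) ⟩
    length Wₚ * (t C m) ∎
    where
    open ≡-Reasoning
    open import Data.List.Membership.DecPropositional (_≟ᵥ_ {m}) using () renaming (_∈?_ to _∈ᵥ?_)
    inP∘ψ≡ : ∀ r → All (_< suc t) (toList r) → (inP (ψ r) ∧ generic r) ≡ (generic r ∧ does (rank r ∈ᵥ? Wₚ))
    inP∘ψ≡ r r<T with generic r in g
    ... | false = ∧-zeroʳ (inP (ψ r))
    ... | true  = trans (∧-identityʳ (inP (ψ r))) (T⇔T⇒≡
      (does-complete (rank r ∈ᵥ? Wₚ) ∘ Equivalence.from (∈-W-P⇔ (suc m) (suc k′) b c _) ∘ Equivalence.to inP⇔)
      (Equivalence.from inP⇔ ∘ Equivalence.to (∈-W-P⇔ (suc m) (suc k′) b c _) ∘ does-sound (rank r ∈ᵥ? Wₚ)))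
      where
      inP⇔ : T (inP (ψ r)) ⇔ InW (suc m) (suc k′) b c (rank r)
      inP⇔ = ScaledMembership.inScaledP⇔InW r r<T (subst T (sym g) _) k′ b c

  decomposition : ∃ λ E → gridCount (suc m) (suc k′) (suc t) b c ≡ length Wₚ * (t C m) + E × E + t P m ≤ suc (suc t) ^ m
  decomposition = E₂ + E₁ , split , bound
    where
    V : List (Vec ℕ m)
    V = grid t m
    E₁ E₂ N₁ N₂ : ℕ
    E₁ = count (λ z → inP z ∧ not (below z)) (grid (suc t) m)
    E₂ = count (λ r → inP (ψ r) ∧ not (generic r)) V
    split : gridCount (suc m) (suc k′) (suc t) b c ≡ length Wₚ * (t C m) + (E₂ + E₁)
    split = begin
      gridCount (suc m) (suc k′) (suc t) b c                ≡⟨ length-filter≡count inP (grid (suc t) m) ⟩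
      count inP (grid (suc t) m)                            ≡⟨ count-split inP below (grid (suc t) m) ⟩
      count (λ z → inP z ∧ below z) (grid (suc t) m) + E₁   ≡⟨ cong (_+ E₁) (count-grid-restrict t m inP) ⟩
      count inP V + E₁                                      ≡⟨ cong (_+ E₁) (count-diffsMod t m inP) ⟩
      count (inP ∘ ψ) V + E₁                                ≡⟨ cong (_+ E₁) (count-split (inP ∘ ψ) generic V) ⟩
      count (λ r → inP (ψ r) ∧ generic r) V + E₂ + E₁       ≡⟨ cong (λ x → x + E₂ + E₁) generic-part ⟩
      length Wₚ * (t C m) + E₂ + E₁                         ≡⟨ +-assoc (length Wₚ * (t C m)) E₂ E₁ ⟩
      length Wₚ * (t C m) + (E₂ + E₁)                       ∎
      where open ≡-Reasoning
    N₁ = count (not ∘ below) (grid (suc t) m)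
    N₂ = count (not ∘ generic) V
    non-generic : t P m + N₂ ≡ suc t ^ m
    non-generic = trans (cong (_+ N₂) (sym (count-distinctOutside t m (0 ∷ []) ([] ∷ []) λ { (here refl) → ∈-upTo⁺ (s≤s z≤n) })))
                        (trans (count+count-not≡length generic V) (length-grid t m))
    below-count : count below (grid (suc t) m) ≡ suc t ^ m
    below-count = trans (count-grid-restrict t m (λ _ → true)) (trans (count-true V) (length-grid t m))
    not-below : suc t ^ m + N₁ ≡ suc (suc t) ^ m
    not-below = begin
      suc t ^ m + N₁                      ≡⟨ cong (_+ N₁) below-count ⟨
      count below (grid (suc t) m) + N₁   ≡⟨ count+count-not≡length below (grid (suc t) m) ⟩
      length (grid (suc t) m)             ≡⟨ length-grid (suc t) m ⟩
      suc (suc t) ^ m                     ∎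
      where open ≡-Reasoning
    bound : E₂ + E₁ + t P m ≤ suc (suc t) ^ m
    bound = begin
      E₂ + E₁ + t P m       ≤⟨ +-monoˡ-≤ (t P m) (+-mono-≤ (count-mono V (λ _ → proj₂ ∘ Equivalence.to T-∧))
                                                                      (count-mono (grid (suc t) m) (λ _ → proj₂ ∘ Equivalence.to T-∧))) ⟩
      N₂ + N₁ + t P m       ≡⟨ solve 3 (λ a b c → a :+ b :+ c := c :+ a :+ b) refl N₂ N₁ (t P m) ⟩
      t P m + N₂ + N₁       ≡⟨ cong (_+ N₁) non-generic ⟩
      suc t ^ m + N₁        ≡⟨ not-below ⟩
      suc (suc t) ^ m       ∎
      where open ≤-Reasoning

-- From lattice-point counts to the volume

2+t-^-≤ : ∀ k t → suc (suc t) ^ k ≤ 2 ^ k * suc t ^ k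
2+t-^-≤ zero    t = ≤-refl
2+t-^-≤ (suc k) t = begin
  suc (suc t) * suc (suc t) ^ k       ≤⟨ *-mono-≤ 2+t≤2[1+t] (2+t-^-≤ k t) ⟩
  (2 * suc t) * (2 ^ k * suc t ^ k)   ≡⟨ solve 3 (λ T a b → (con 2 :* T) :* (a :* b) := (con 2 :* a) :* (T :* b)) refl (suc t) (2 ^ k) (suc t ^ k) ⟩
  (2 * 2 ^ k) * (suc t * suc t ^ k)   ∎
  where
  open ≤-Reasoning
  2+t≤2[1+t] : suc (suc t) ≤ 2 * suc t
  2+t≤2[1+t] = ≤-trans (+-monoˡ-≤ (suc t) (s≤s z≤n)) (≤-reflexive (cong (suc t +_) (sym (+-identityʳ (suc t)))))

falling-gap : ∀ n′ t → suc (suc t) ^ suc n′ ∸ t P suc n′ ≤ fallingConst 2 n′ * 2 ^ n′ * suc t ^ n′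
falling-gap n′ t = begin
  suc (suc t) ^ suc n′ ∸ t P suc n′         ≤⟨ m≤n+o⇒m∸n≤o _ (t P suc n′) (subst (λ x → x ^ suc n′ ≤ t P suc n′ + K * x ^ n′) (+-comm t 2) (^-P-gap n′ t 2)) ⟩
  K * suc (suc t) ^ n′                      ≤⟨ *-monoʳ-≤ K (2+t-^-≤ n′ t) ⟩
  K * (2 ^ n′ * suc t ^ n′)                 ≡⟨ *-assoc K (2 ^ n′) (suc t ^ n′) ⟨
  K * 2 ^ n′ * suc t ^ n′                   ∎
  where
  open ≤-Reasoning
  K : ℕ
  K = fallingConst 2 n′

sandwich : ∀ {G W N E F f Z D} → G ≡ W * N + E → N * f ≡ F → E ≤ D → F ≤ Z → Z ≤ F + D →
           G * f ≤ W * Z + (f + W) * D × W * Z ≤ G * f + (f + W) * D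
sandwich {G} {W} {N} {E} {F} {f} {Z} {D} G≡ Cf≡F E≤D F≤Z Z≤F+D = upper , lower
  where
  open ≤-Reasoning
  Gf≡ : G * f ≡ W * F + E * f
  Gf≡ = begin-equality
    G * f                 ≡⟨ cong (_* f) G≡ ⟩
    (W * N + E) * f       ≡⟨ *-distribʳ-+ f (W * N) E ⟩
    W * N * f + E * f     ≡⟨ cong (_+ E * f) (trans (*-assoc W N f) (cong (W *_) Cf≡F)) ⟩
    W * F + E * f         ∎
  upper : G * f ≤ W * Z + (f + W) * D
  upper = begin
    G * f                 ≡⟨ Gf≡ ⟩
    W * F + E * f         ≤⟨ +-mono-≤ (*-monoʳ-≤ W F≤Z) (*-monoˡ-≤ f E≤D) ⟩
    W * Z + D * f         ≡⟨ cong (W * Z +_) (*-comm D f) ⟩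
    W * Z + f * D         ≤⟨ +-monoʳ-≤ (W * Z) (*-monoˡ-≤ D (m≤m+n f W)) ⟩
    W * Z + (f + W) * D   ∎
  lower : W * Z ≤ G * f + (f + W) * D
  lower = begin
    W * Z                      ≤⟨ *-monoʳ-≤ W Z≤F+D ⟩
    W * (F + D)                ≡⟨ *-distribˡ-+ W F D ⟩
    W * F + W * D              ≤⟨ +-mono-≤ (m≤m+n (W * F) (E * f)) (*-monoˡ-≤ D (m≤n+m W f)) ⟩
    W * F + E * f + (f + W) * D ≡⟨ cong (_+ (f + W) * D) Gf≡ ⟨
    G * f + (f + W) * D        ∎

∣⊖∣≤ : ∀ {a x e} → a ≤ x + e → x ≤ a + e → ℤ.∣ a ⊖ x ∣ ≤ e
∣⊖∣≤ {a} {x} {e} a≤ x≤ with ≤-total x a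
... | inj₁ x≤a = subst (_≤ e) (sym (cong ℤ.∣_∣ (ℤP.⊖-≥ x≤a))) (m≤n+o⇒m∸n≤o a x a≤)
... | inj₂ a≤x = subst (_≤ e) (sym (ℤP.∣⊖∣-≤ a≤x)) (m≤n+o⇒m∸n≤o x a x≤)

ℕtoℚ≡mkℚ : ∀ a → ℕtoℚ a ≡ mkℚ (ℤ.+ a) 0 (Coprime.sym (Coprime.1-coprimeTo a))
ℕtoℚ≡mkℚ a = ℚP.normalize-coprime (Coprime.sym (Coprime.1-coprimeTo a))

-- The inequality is transported to unnormalised rationals, where it is one cross-multiplied integer inequality.
ℕ-close⇒ℚ-close : ∀ (a w z e p q : ℕ) .(cop : Coprime.Coprime (suc p) (suc q)) →
  a ≤ w * z + e → w * z ≤ a + e → e * suc q < suc p * z →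
  ℚ.∣ ℕtoℚ a ℚ.- ℕtoℚ w ℚ.* ℕtoℚ z ∣ ℚ.< mkℚ (ℤ.+ suc p) q cop ℚ.* ℕtoℚ z
ℕ-close⇒ℚ-close a w z e p q cop a≤ wz≤ eq<pz rewrite ℕtoℚ≡mkℚ a | ℕtoℚ≡mkℚ w | ℕtoℚ≡mkℚ z =
  ℚP.toℚᵘ-cancel-< (ℚᵘP.<-respˡ-≃ (ℚᵘP.≃-sym lhs≃) (ℚᵘP.<-respʳ-≃ (ℚᵘP.≃-sym (ℚP.toℚᵘ-homo-* ε z′)) (ℚᵘ.*<* cross)))
  where
  open import Data.Integer.Base using (+_)
  a′ w′ z′ ε : ℚ
  a′ = mkℚ (+ a) 0 (Coprime.sym (Coprime.1-coprimeTo a))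
  w′ = mkℚ (+ w) 0 (Coprime.sym (Coprime.1-coprimeTo w))
  z′ = mkℚ (+ z) 0 (Coprime.sym (Coprime.1-coprimeTo z))
  ε = mkℚ (+ suc p) q cop
  lhs≃ : ℚ.toℚᵘ (ℚ.∣ a′ ℚ.- w′ ℚ.* z′ ∣) ℚᵘ.≃ ℚᵘ.∣ mkℚᵘ (+ a) 0 ℚᵘ.- mkℚᵘ (+ w) 0 ℚᵘ.* mkℚᵘ (+ z) 0 ∣
  lhs≃ = ℚᵘP.≃-trans (ℚP.toℚᵘ-homo-∣-∣ (a′ ℚ.- w′ ℚ.* z′))
           (ℚᵘP.∣-∣-cong (ℚᵘP.≃-trans (ℚP.toℚᵘ-homo-+ a′ (ℚ.- (w′ ℚ.* z′)))
             (ℚᵘP.+-cong (ℚᵘP.≃-refl {mkℚᵘ (+ a) 0}) (ℚᵘP.≃-trans (ℚP.toℚᵘ-homo‿- (w′ ℚ.* z′)) (ℚᵘP.-‿cong (ℚP.toℚᵘ-homo-* w′ z′))))))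
  difference : + a ℤ.* + 1 ℤ.+ ℤ.- (+ w ℤ.* + z) ℤ.* + 1 ≡ a ⊖ w * z
  difference = trans (cong₂ ℤ._+_ (ℤP.*-identityʳ (+ a)) (trans (ℤP.*-identityʳ _) (cong ℤ.-_ (sym (ℤP.pos-* w z)))))
                     (ℤP.m-n≡m⊖n a (w * z))
  cross : + ℤ.∣ + a ℤ.* + 1 ℤ.+ ℤ.- (+ w ℤ.* + z) ℤ.* + 1 ∣ ℤ.* + suc (q * 1) ℤ.< (+ suc p ℤ.* + z) ℤ.* + 1
  cross = subst₂ ℤ._<_
    (sym (trans (cong (λ x → + ℤ.∣ x ∣ ℤ.* + suc (q * 1)) difference) (sym (ℤP.pos-* ℤ.∣ a ⊖ w * z ∣ (suc (q * 1))))))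
    (sym (trans (ℤP.*-identityʳ _) (sym (ℤP.pos-* (suc p) z))))
    (ℤ.+<+ (≤-<-trans (*-mono-≤ (∣⊖∣≤ a≤ wz≤) (≤-reflexive (cong suc (*-identityʳ q)))) eq<pz))

errorConstant : ℕ → ℕ → ℕ
errorConstant n′ W = (suc n′ ! + W) * (fallingConst 2 n′ * 2 ^ n′)

count-error : ∀ n′ k′ t b c →
  let G : ℕ
      G = gridCount (suc (suc n′)) (suc k′) (suc t) b c * suc n′ !
      W : ℕ
      W = length (W-P (suc (suc n′)) (suc k′) b c)
      Z : ℕ
      Z = suc t ^ suc n′
  in Σ ℕ λ e → G ≤ W * Z + e × W * Z ≤ G + e × e ≤ errorConstant n′ W * suc t ^ n′
count-error n′ k′ t b c = (m ! + W) * D , proj₁ close , proj₂ close , e≤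
  where
  open GridCount n′ k′ t b c using (m; decomposition)
  W : ℕ
  W = length (W-P (suc (suc n′)) (suc k′) b c)
  D : ℕ
  D = suc (suc t) ^ m ∸ t P m
  F≤ : t P m ≤ suc (suc t) ^ m
  F≤ = ≤-trans (P≤^ t m) (^-monoˡ-≤ m (≤-trans (n≤1+n t) (n≤1+n (suc t))))
  close : gridCount (suc m) (suc k′) (suc t) b c * m ! ≤ W * suc t ^ m + (m ! + W) * D ×
          W * suc t ^ m ≤ gridCount (suc m) (suc k′) (suc t) b c * m ! + (m ! + W) * D
  close = sandwich (proj₁ (proj₂ decomposition)) (trans (*-comm (t C m) (m !)) (k!*nCk≡nPk t m))
    (m+n≤o⇒m≤o∸n (proj₁ decomposition) (proj₂ (proj₂ decomposition)))
    (≤-trans (P≤^ t m) (^-monoˡ-≤ m (n≤1+n t)))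
    (subst (suc t ^ m ≤_) (sym (m+[n∸m]≡n F≤)) (^-monoˡ-≤ m (n≤1+n (suc t))))
  e≤ : (m ! + W) * D ≤ errorConstant n′ W * suc t ^ n′
  e≤ = ≤-trans (*-monoʳ-≤ (m ! + W) (falling-gap n′ t)) (≤-reflexive (sym (*-assoc (m ! + W) _ (suc t ^ n′))))

eventually-small : ∀ {e M n′ t} p q → e ≤ M * suc t ^ n′ → M * suc q ≤ t → e * suc q < suc p * suc t ^ suc n′
eventually-small {e} {M} {n′} {t} p q e≤ Mq≤t = begin-strict
  e * suc q                   ≤⟨ *-monoˡ-≤ (suc q) e≤ ⟩
  M * suc t ^ n′ * suc q      ≡⟨ solve 3 (λ M T q → M :* T :* q := M :* q :* T) refl M (suc t ^ n′) (suc q) ⟩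
  M * suc q * suc t ^ n′      ≤⟨ *-monoˡ-≤ (suc t ^ n′) Mq≤t ⟩
  t * suc t ^ n′              <⟨ *-monoˡ-< (suc t ^ n′) {{ℕ.>-nonZero (m^n>0 (suc t) n′)}} (n<1+n t) ⟩
  suc t ^ suc n′              ≤⟨ m≤n*m (suc t ^ suc n′) (suc p) ⟩
  suc p * suc t ^ suc n′      ∎
  where open ≤-Reasoning

volume-limit : ∀ n′ k′ b c (ε : ℚ) → ℚ.Positive ε → Σ ℕ λ N → (t : ℕ) → N ≤ t →
  ℚ.∣ ℕtoℚ (gridCount (suc (suc n′)) (suc k′) (suc t) b c * suc n′ !)
      ℚ.- ℕtoℚ (length (W-P (suc (suc n′)) (suc k′) b c)) ℚ.* ℕtoℚ (suc t ^ suc n′) ∣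
    ℚ.< ε ℚ.* ℕtoℚ (suc t ^ suc n′)
volume-limit n′ k′ b c (mkℚ (ℤ.+ suc p) q cop) _ = errorConstant n′ W * suc q , λ t N≤t →
  let e , upper , lower , e≤ = count-error n′ k′ t b c in
  ℕ-close⇒ℚ-close (gridCount (suc (suc n′)) (suc k′) (suc t) b c * suc n′ !) W (suc t ^ suc n′) e p q cop
    upper lower (eventually-small {M = errorConstant n′ W} {n′} p q e≤ N≤t)
  where
  W : ℕ
  W = length (W-P (suc (suc n′)) (suc k′) b c)
volume-limit n′ k′ b c (mkℚ (ℤ.+ zero)   _ _) ε>0 = ⊥-elim (ℤ.Positive.pos ε>0)
volume-limit n′ k′ b c (mkℚ ℤ.-[1+ _ ] _ _) ε>0 = ⊥-elim (ℤ.Positive.pos ε>0)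

proposition6p1 : (n k : ℕ) → 0 < k → k < n → (b c : ℕ → ℕ → ℤ) →
    Σ (List (Vec ℕ (n ∸ 1))) λ WP →
      Unique WP × (∀ w → (w ∈ WP) ⇔ InW n k b c w) ×
      -- normalized volume of P = |W_P|, volume being the Jordan content:
      -- (n-1)! * gridCount(t) / t^(n-1)  →  length WP   as t → ∞
      ((ε : ℚ) → ℚ.Positive ε → Σ ℕ λ N → (t : ℕ) → N ≤ t →
        ℚ.∣ ℕtoℚ (gridCount n k (suc t) b c * (n ∸ 1) !)
            ℚ.- ℕtoℚ (length WP) ℚ.* ℕtoℚ (suc t ^ (n ∸ 1)) ∣
          ℚ.< ε ℚ.* ℕtoℚ (suc t ^ (n ∸ 1)))
proposition6p1 (suc (suc n′)) (suc k′) _ _ b c =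
  W-P n k b c , W-P-unique n k b c , ∈-W-P⇔ n k b c , volume-limit n′ k′ b c
  where
  n k : ℕ
  n = suc (suc n′)
  k = suc k′
proposition6p1 (suc zero) (suc k′) _ (s≤s ()) b c
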